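{- Let $\mathcal B_1$ be the collection of bases of a Lagrangian orthogonal matroid on $[n]\cup[n]^*$, let $i\in[n]$, and let $\mathcal B_2=\{\sigma(B):B\in\mathcal B_1\}$ where $\sigma$ is the transposition $(i,i^*)$ acting elementwise. Then $\mathcal B_1$ and $\mathcal B_2$ form a Lagrangian pair.
   Context: $J=[n]\cup[n]^*$ with involution $i\mapsto i^*$, $i^*\mapsto i$; $K\subseteq J$ is admissible if $K\cap K^*=\emptyset$. A $D_n$-admissible ordering: choose an admissible $n$-set listed from largest to smallest $x_1\succ\cdots\succ x_n$ and declare $x_1\succ\cdots\succ x_{n-1}\succ x_n,x_n^*\succ x_{n-1}^*\succ\cdots\succ x_1^*$, with $x_n,x_n^*$ incomparable. For admissible $n$-sets $A=\{a_1\prec\cdots\prec a_n\}$, $B=\{b_1\prec\cdots\prec b_n\}$, Gale order: $A\preceq B$ iff $a_j\preceq b_j$ for all $j$. A Lagrangian orthogonal matroid is a collection of admissible $n$-subsets of $J$ having, for every $D_n$-admissible ordering, a unique Gale-maximal member; all its bases have the same parity (parity of number of starred elements). Two Lagrangian orthogonal matroids of opposite parity form a Lagrangian pair if for every $D_n$-admissible ordering their maximal bases have symmetric difference $\{j,j^*\}$ for some $j$. -}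

module Defs where

open import Data.Nat using (ℕ; suc; _+_)
open import Data.Nat.Properties using ()
open import Data.Bool using (Bool; true; false; not; if_then_else_)
open import Data.Fin using (Fin; toℕ; _≟_) renaming (_<_ to _<ᶠ_)
open import Data.Fin.Subset using (Subset; _∈_; ∣_∣; inside; outside)
open import Data.Vec using (Vec; lookup; tabulate)
open import Data.Product using (Σ; ∃; _×_; _,_; proj₁; proj₂)
open import Data.Sum using (_⊎_)
open import Relation.Nullary using (¬_; yes; no)
open import Relation.Binary.PropositionalEquality using (_≡_; _≢_)
open import Function.Definitions using (Injective)

-- The ground set J = [n] ∪ [n]*.
-- (k , false) represents k ∈ [n];  (k , true) represents k* ∈ [n]*.

J : ℕ → Set
J n = Fin n × Bool

_* : ∀ {n} → J n → J n
(k , b) * = (k , not b)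

-- Subsets of J: a pair (P , Q) of subsets of [n];
-- P records the unstarred members, Q the starred members.

SubJ : ℕ → Set
SubJ n = Subset n × Subset n

_∈J_ : ∀ {n} → J n → SubJ n → Set
(k , false) ∈J (P , Q) = k ∈ P
(k , true)  ∈J (P , Q) = k ∈ Q

_∉J_ : ∀ {n} → J n → SubJ n → Set
j ∉J K = ¬ (j ∈J K)

cardJ : ∀ {n} → SubJ n → ℕ
cardJ (P , Q) = ∣ P ∣ + ∣ Q ∣

starCount : ∀ {n} → SubJ n → ℕ
starCount (P , Q) = ∣ Q ∣

Admissible : ∀ {n} → SubJ n → Set
Admissible K = ∀ j → j ∈J K → (j *) ∉J K

AdmissibleNSet : ∀ {n} → SubJ n → Set
AdmissibleNSet {n} K = Admissible K × cardJ K ≡ n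

-- D_n-admissible orderings.
-- Data: an admissible n-set listed from largest to smallest,
-- x 0 ≻ x 1 ≻ ⋯ ≻ x (n-1)  (0-based indices).

record DnOrdering (n : ℕ) : Set where
  field
    x     : Fin n → J n
    x-inj : Injective _≡_ _≡_ x
    x-adm : ∀ k l → x k ≢ (x l) *

open DnOrdering public

-- Above o a b  means  a ≻ b  in the ordering determined by o:
--   x₁ ≻ ⋯ ≻ xₙ₋₁ ≻ xₙ , xₙ* ≻ xₙ₋₁* ≻ ⋯ ≻ x₁*,  with xₙ, xₙ* incomparable.
data Above {n : ℕ} (o : DnOrdering n) : J n → J n → Set where
  unst-unst : ∀ {k l} → k <ᶠ l → Above o (x o k) (x o l)
  unst-star : ∀ {k l} → ¬ (k ≡ l × suc (toℕ k) ≡ n) → Above o (x o k) ((x o l) *)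
  star-star : ∀ {k l} → l <ᶠ k → Above o ((x o k) *) ((x o l) *)

_≺⟨_⟩_ : ∀ {n} → J n → DnOrdering n → J n → Set
a ≺⟨ o ⟩ b = Above o b a

_⪯⟨_⟩_ : ∀ {n} → J n → DnOrdering n → J n → Set
a ⪯⟨ o ⟩ b = a ≡ b ⊎ Above o b a

IncreasingEnum : ∀ {n} → DnOrdering n → SubJ n → (Fin n → J n) → Set
IncreasingEnum {n} o A a =
  (∀ k l → k <ᶠ l → a k ≺⟨ o ⟩ a l) × (∀ y → (y ∈J A → ∃ λ k → a k ≡ y) × ((∃ λ k → a k ≡ y) → y ∈J A))

GaleLeq : ∀ {n} → DnOrdering n → SubJ n → SubJ n → Set
GaleLeq {n} o A B =
  Σ (Fin n → J n) λ a → Σ (Fin n → J n) λ b →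
    IncreasingEnum o A a × IncreasingEnum o B b × (∀ k → a k ⪯⟨ o ⟩ b k)

IsGaleMaximal : ∀ {n} → DnOrdering n → (SubJ n → Set) → SubJ n → Set
IsGaleMaximal o 𝓑 M = 𝓑 M × (∀ B → 𝓑 B → GaleLeq o M B → B ≡ M)

HasUniqueGaleMax : ∀ {n} → DnOrdering n → (SubJ n → Set) → Set
HasUniqueGaleMax o 𝓑 =
  Σ _ λ M → IsGaleMaximal o 𝓑 M × (∀ M' → IsGaleMaximal o 𝓑 M' → M' ≡ M)

LagrangianOrthogonalMatroid : (n : ℕ) → (SubJ n → Set) → Set
LagrangianOrthogonalMatroid n 𝓑 =
  (∀ B → 𝓑 B → AdmissibleNSet B) × (∀ (o : DnOrdering n) → HasUniqueGaleMax o 𝓑)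

parity : ℕ → Bool
parity 0 = false
parity (suc m) = not (parity m)

OppositeParity : ∀ {n} → (SubJ n → Set) → (SubJ n → Set) → Set
OppositeParity 𝓑₁ 𝓑₂ =
  ∀ B₁ B₂ → 𝓑₁ B₁ → 𝓑₂ B₂ → parity (starCount B₁) ≢ parity (starCount B₂)

SymDiffIsPair : ∀ {n} → SubJ n → SubJ n → J n → Set
SymDiffIsPair M₁ M₂ j =
  ∀ y → (((y ∈J M₁ × y ∉J M₂) ⊎ (y ∈J M₂ × y ∉J M₁)) → (y ≡ j ⊎ y ≡ j *))
      × ((y ≡ j ⊎ y ≡ j *) → ((y ∈J M₁ × y ∉J M₂) ⊎ (y ∈J M₂ × y ∉J M₁)))

LagrangianPair : (n : ℕ) → (SubJ n → Set) → (SubJ n → Set) → Set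
LagrangianPair n 𝓑₁ 𝓑₂ =
  LagrangianOrthogonalMatroid n 𝓑₁ × LagrangianOrthogonalMatroid n 𝓑₂ ×
  OppositeParity 𝓑₁ 𝓑₂ ×
  (∀ (o : DnOrdering n) M₁ M₂ → IsGaleMaximal o 𝓑₁ M₁ → IsGaleMaximal o 𝓑₂ M₂ →
     ∃ λ j → SymDiffIsPair M₁ M₂ j)

transp : ∀ {n} → Fin n → J n → J n
transp i (k , b) with k ≟ i
... | yes _ = (k , not b)
... | no  _ = (k , b)

memb : ∀ {n} → J n → SubJ n → Bool
memb (k , false) (P , Q) = lookup P k
memb (k , true)  (P , Q) = lookup Q k

-- σ(K) = { σ y : y ∈ K };  since σ is an involution, y ∈ σ(K) iff σ y ∈ K
transpSet : ∀ {n} → Fin n → SubJ n → SubJ n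
transpSet i K = (tabulate λ k → memb (transp i (k , false)) K)
              , (tabulate λ k → memb (transp i (k , true)) K)

imageCollection : ∀ {n} → Fin n → (SubJ n → Set) → (SubJ n → Set)
imageCollection i 𝓑 K = ∃ λ B → 𝓑 B × K ≡ transpSet i B

-- Read an admissible n-set K along a D_n-admissible ordering x₁ ≻ ⋯ ≻ xₙ through its signature, the
-- boolean sequence telling whether K contains xⱼ or xⱼ*. The Gale order becomes domination of prefix
-- counts, so the unique maximal base dominates every base. All bases have the same parity (by descent
-- on their distance) and satisfy symmetric exchange, both seen on orderings listing first the indices
-- where two bases agree; as σ changes the number of starred elements by one, 𝓑₁ and 𝓑₂ have opposite
-- parities. For an ordering x with maximal bases M₁ of 𝓑₁ and M₂ of 𝓑₂, σ(M₂) is the maximal base of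
-- 𝓑₁ for σx, whose signatures are those for x flipped at the position of i. Away from that position
-- the signatures of M₁ and σ(M₂) differ at exactly one position: parity excludes none, and a second
-- one would let two symmetric exchanges beat M₁ or σ(M₂) lexicographically. Hence σ(M₂) = σ σ_q M₁,
-- that is M₂ = σ_q M₁, and M₁ Δ M₂ = {q, q*}.

module Submission where

open import Defs
open import Data.Nat as ℕ using (ℕ; zero; suc; _+_; _∸_; _≤_; _<_; z≤n; s≤s; _<ᵇ_; _≡ᵇ_)
import Data.Nat.Properties as ℕ
open import Data.Bool as Bool using (Bool; true; false; not; _∧_; _∨_; _xor_; if_then_else_)
open import Data.Bool.Properties
  using ( not-involutive; not-injective; not-¬; ¬-not; not-distribˡ-xor; xor-same; xor-assoc; xor-comm
        ; xor-identityʳ; xor-annihilates-not; xor-∧-commutativeRing; ∧-identityʳ; ∧-zeroʳ; ∨-identityʳ; ∨-zeroʳ)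
open import Data.Fin as Fin using (Fin; zero; suc; toℕ; fromℕ<; punchOut)
import Data.Fin.Properties as Fin
import Data.Fin.Permutation as Perm
open import Data.Fin.Subset using (∣_∣)
open import Data.Vec using (Vec; []; _∷_; lookup)
import Data.Vec.Properties as Vec
open import Data.List as List using (List; []; _∷_; _++_; length; filterᵇ)
import Data.List.Properties as List
open import Data.Product using (_×_; _,_; proj₁; proj₂; ∃)
import Data.Product.Properties as Product
open import Data.Sum using (_⊎_; inj₁; inj₂; [_,_]′)
open import Data.Empty using (⊥; ⊥-elim)
open import Function.Base using (id; _∘_; _∘′_)
open import Function.Definitions using (Injective)
open import Relation.Nullary using (Dec; yes; no; ¬_; ¬?; does)
open import Relation.Nullary.Decidable
  using (decidable-stable; map′; _×-dec_; _→-dec_; dec-true; dec-false; ¬¬-excluded-middle)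
open import Relation.Nullary.Negation using (¬¬-map)
open import Relation.Binary.Definitions using (tri<; tri≈; tri>)
open import Relation.Binary.PropositionalEquality hiding (J)
open import Algebra.Bundles using (CommutativeRing)
import Algebra.Properties.CommutativeSemigroup as CommSemigroupProperties
open import Algebra.Properties.CommutativeMonoid.Sum ℕ.+-0-commutativeMonoid
  using (sum; sum-cong-≗; sum-permute; sum-init-last; ∑-distrib-+)

module Xor = CommSemigroupProperties (CommutativeRing.+-commutativeSemigroup xor-∧-commutativeRing)
module ℕ+ = CommSemigroupProperties ℕ.+-commutativeSemigroup

-- Booleans, parity and Hamming distance

𝟙 : Bool → ℕ
𝟙 true = 1
𝟙 false = 0

𝟙≤1 : ∀ a → 𝟙 a ≤ 1
𝟙≤1 true = ℕ.≤-refl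
𝟙≤1 false = z≤n

false≢true : false ≢ true
false≢true ()

xor-true : ∀ a → a xor true ≡ not a
xor-true true = refl
xor-true false = refl

xor≡true⇒≢ : ∀ {a b} → a xor b ≡ true → a ≢ b
xor≡true⇒≢ {true} {true} () refl
xor≡true⇒≢ {false} {false} () refl

≢⇒xor≡true : ∀ {a b} → a ≢ b → a xor b ≡ true
≢⇒xor≡true {true} {false} _ = refl
≢⇒xor≡true {false} {true} _ = refl
≢⇒xor≡true {true} {true} a≢b = ⊥-elim (a≢b refl)
≢⇒xor≡true {false} {false} a≢b = ⊥-elim (a≢b refl)

xor≡true⇒≡not : ∀ {a b} → a xor b ≡ true → b ≡ not a
xor≡true⇒≡not {true} {false} _ = refl
xor≡true⇒≡not {false} {true} _ = refl

xor-cancelʳ : ∀ a c → (a xor c) xor c ≡ a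
xor-cancelʳ a c = trans (xor-assoc a c c) (trans (cong (a xor_) (xor-same c)) (xor-identityʳ a))

xor-xor-cancel : ∀ a b c → ((a xor c) xor b) xor c ≡ a xor b
xor-xor-cancel a b c = trans (cong (_xor c) (Xor.xy∙z≈xz∙y a c b)) (xor-cancelʳ (a xor b) c)

<ᵇ⇒< : ∀ a b → (a <ᵇ b) ≡ true → a < b
<ᵇ⇒< zero (suc b) _ = s≤s z≤n
<ᵇ⇒< (suc a) (suc b) eq = s≤s (<ᵇ⇒< a b eq)

<⇒<ᵇ : ∀ a b → a < b → (a <ᵇ b) ≡ true
<⇒<ᵇ zero (suc b) _ = refl
<⇒<ᵇ (suc a) (suc b) (s≤s a<b) = <⇒<ᵇ a b a<b

≮⇒<ᵇ : ∀ a b → ¬ a < b → (a <ᵇ b) ≡ false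
≮⇒<ᵇ a b a≮b with a <ᵇ b in eq
... | true = ⊥-elim (a≮b (<ᵇ⇒< a b eq))
... | false = refl

≡ᵇ⇒≡ : ∀ a b → (a ≡ᵇ b) ≡ true → a ≡ b
≡ᵇ⇒≡ zero zero _ = refl
≡ᵇ⇒≡ (suc a) (suc b) eq = cong suc (≡ᵇ⇒≡ a b eq)

≡ᵇ-refl : ∀ a → (a ≡ᵇ a) ≡ true
≡ᵇ-refl zero = refl
≡ᵇ-refl (suc a) = ≡ᵇ-refl a

≡ᵇ-true : ∀ {a b} → a ≡ b → (a ≡ᵇ b) ≡ true
≡ᵇ-true {a} refl = ≡ᵇ-refl a

≢⇒≡ᵇ : ∀ {a b} → a ≢ b → (a ≡ᵇ b) ≡ false
≢⇒≡ᵇ {a} {b} a≢b with a ≡ᵇ b in eq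
... | true = ⊥-elim (a≢b (≡ᵇ⇒≡ a b eq))
... | false = refl

parity-+ : ∀ a b → parity (a + b) ≡ parity a xor parity b
parity-+ zero b = refl
parity-+ (suc a) b = trans (cong not (parity-+ a b)) (not-distribˡ-xor (parity a) (parity b))

parity-𝟙 : ∀ a → parity (𝟙 a) ≡ a
parity-𝟙 true = refl
parity-𝟙 false = refl

hamming : ∀ {n} → Vec Bool n → Vec Bool n → ℕ
hamming [] [] = 0
hamming (a ∷ A) (b ∷ B) = 𝟙 (a xor b) + hamming A B

hamming≡sum : ∀ {n} (A B : Vec Bool n) → hamming A B ≡ sum (λ q → 𝟙 (lookup A q xor lookup B q))
hamming≡sum [] [] = refl
hamming≡sum (a ∷ A) (b ∷ B) = cong (𝟙 (a xor b) +_) (hamming≡sum A B)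

parity-hamming : ∀ {n} (A B : Vec Bool n) → parity ∣ A ∣ xor parity ∣ B ∣ ≡ parity (hamming A B)
parity-hamming [] [] = refl
parity-hamming (a ∷ A) (b ∷ B) = begin
  parity ∣ a ∷ A ∣ xor parity ∣ b ∷ B ∣
    ≡⟨ cong₂ _xor_ (parity-∷ a A) (parity-∷ b B) ⟩
  (a xor parity ∣ A ∣) xor (b xor parity ∣ B ∣)
    ≡⟨ Xor.interchange a (parity ∣ A ∣) b (parity ∣ B ∣) ⟩
  (a xor b) xor (parity ∣ A ∣ xor parity ∣ B ∣)
    ≡⟨ cong₂ _xor_ (sym (parity-𝟙 (a xor b))) (parity-hamming A B) ⟩
  parity (𝟙 (a xor b)) xor parity (hamming A B)
    ≡⟨ sym (parity-+ (𝟙 (a xor b)) (hamming A B)) ⟩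
  parity (hamming (a ∷ A) (b ∷ B)) ∎
  where
  open ≡-Reasoning
  parity-∷ : ∀ {m} x (X : Vec Bool m) → parity ∣ x ∷ X ∣ ≡ x xor parity ∣ X ∣
  parity-∷ true X = refl
  parity-∷ false X = refl

hamming-one : ∀ {n} (A B : Vec Bool n) i → (∀ k → k ≢ i → lookup A k ≡ lookup B k) →
              lookup A i ≢ lookup B i → hamming A B ≡ 1
hamming-one (a ∷ A) (b ∷ B) zero agree differ =
  cong₂ _+_ (cong 𝟙 (≢⇒xor≡true differ)) (hamming-zero A B (λ k → agree (suc k) (λ ())))
  where
  hamming-zero : ∀ {n} (A B : Vec Bool n) → (∀ k → lookup A k ≡ lookup B k) → hamming A B ≡ 0
  hamming-zero [] [] _ = refl
  hamming-zero (a ∷ A) (b ∷ B) eq with eq zero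
  ... | refl = cong₂ _+_ (cong 𝟙 (xor-same a)) (hamming-zero A B (eq ∘ suc))
hamming-one (a ∷ A) (b ∷ B) (suc i) agree differ with agree zero (λ ())
... | refl = cong₂ _+_ (cong 𝟙 (xor-same a))
                (hamming-one A B i (λ k k≢i → agree (suc k) (k≢i ∘ Fin.suc-injective)) differ)

hamming-positive : ∀ {n} (A B : Vec Bool n) → 0 < hamming A B → ∃ λ q → lookup A q ≢ lookup B q
hamming-positive [] [] ()
hamming-positive (a ∷ A) (b ∷ B) pos with a Bool.≟ b
... | no a≢b = zero , a≢b
... | yes refl with hamming-positive A B (subst (0 <_) (cong (_+ hamming A B) (cong 𝟙 (xor-same a))) pos)
... | q , differs = suc q , differs

-- Admissible n-sets and the transposition σᵢ = (i i*)

∈J⇒memb : ∀ {n} (y : J n) K → y ∈J K → memb y K ≡ true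
∈J⇒memb (k , false) (P , Q) = Vec.[]=⇒lookup
∈J⇒memb (k , true) (P , Q) = Vec.[]=⇒lookup

memb⇒∈J : ∀ {n} (y : J n) K → memb y K ≡ true → y ∈J K
memb⇒∈J (k , false) (P , Q) = Vec.lookup⇒[]= k P
memb⇒∈J (k , true) (P , Q) = Vec.lookup⇒[]= k Q

∣P∣+∣Q∣≤n : ∀ {n} (P Q : Vec Bool n) → (∀ k → lookup P k ≡ true → lookup Q k ≢ true) →
            ∣ P ∣ + ∣ Q ∣ ≤ n
∣P∣+∣Q∣≤n [] [] _ = z≤n
∣P∣+∣Q∣≤n (true ∷ P) (true ∷ Q) disj = ⊥-elim (disj zero refl refl)
∣P∣+∣Q∣≤n (true ∷ P) (false ∷ Q) disj = s≤s (∣P∣+∣Q∣≤n P Q (disj ∘ suc))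
∣P∣+∣Q∣≤n (false ∷ P) (true ∷ Q) disj rewrite ℕ.+-suc ∣ P ∣ ∣ Q ∣ =
  s≤s (∣P∣+∣Q∣≤n P Q (disj ∘ suc))
∣P∣+∣Q∣≤n (false ∷ P) (false ∷ Q) disj = ℕ.m≤n⇒m≤1+n (∣P∣+∣Q∣≤n P Q (disj ∘ suc))

disjoint-cover⇒complement : ∀ {n} (P Q : Vec Bool n) → (∀ k → lookup P k ≡ true → lookup Q k ≢ true) →
                            ∣ P ∣ + ∣ Q ∣ ≡ n → ∀ k → lookup Q k ≡ not (lookup P k)
disjoint-cover⇒complement (true ∷ P) (true ∷ Q) disj _ _ = ⊥-elim (disj zero refl refl)
disjoint-cover⇒complement (true ∷ P) (false ∷ Q) _ _ zero = refl
disjoint-cover⇒complement (true ∷ P) (false ∷ Q) disj eq (suc k) =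
  disjoint-cover⇒complement P Q (disj ∘ suc) (ℕ.suc-injective eq) k
disjoint-cover⇒complement (false ∷ P) (true ∷ Q) _ _ zero = refl
disjoint-cover⇒complement (false ∷ P) (true ∷ Q) disj eq (suc k) =
  disjoint-cover⇒complement P Q (disj ∘ suc) (ℕ.suc-injective (trans (sym (ℕ.+-suc ∣ P ∣ ∣ Q ∣)) eq)) k
disjoint-cover⇒complement {suc n} (false ∷ P) (false ∷ Q) disj eq _ =
  ⊥-elim (ℕ.1+n≰n (subst (_≤ n) eq (∣P∣+∣Q∣≤n P Q (disj ∘ suc))))

complement⇒∣P∣+∣Q∣≡n : ∀ {n} (P Q : Vec Bool n) → (∀ k → lookup Q k ≡ not (lookup P k)) →
                       ∣ P ∣ + ∣ Q ∣ ≡ n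
complement⇒∣P∣+∣Q∣≡n [] [] _ = refl
complement⇒∣P∣+∣Q∣≡n (true ∷ P) (q ∷ Q) compl with compl zero
... | refl = cong suc (complement⇒∣P∣+∣Q∣≡n P Q (compl ∘ suc))
complement⇒∣P∣+∣Q∣≡n (false ∷ P) (q ∷ Q) compl with compl zero
... | refl = trans (ℕ.+-suc ∣ P ∣ ∣ Q ∣) (cong suc (complement⇒∣P∣+∣Q∣≡n P Q (compl ∘ suc)))

memberAt : ∀ {n} → SubJ n → Fin n → J n
memberAt K q = (q , not (memb (q , false) K))

Agree : ∀ {n} → SubJ n → SubJ n → Fin n → Bool
Agree K K′ q = not (memb (q , false) K xor memb (q , false) K′)

module _ {n} {K : SubJ n} (K-adm : AdmissibleNSet K) where

  memb-starred : ∀ q → memb (q , true) K ≡ not (memb (q , false) K)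
  memb-starred = disjoint-cover⇒complement (proj₁ K) (proj₂ K) disj (proj₂ K-adm)
    where
    disj : ∀ k → lookup (proj₁ K) k ≡ true → lookup (proj₂ K) k ≢ true
    disj k p q = proj₁ K-adm (k , false) (memb⇒∈J (k , false) K p) (memb⇒∈J (k , true) K q)

  memb-* : ∀ y → memb (y *) K ≡ not (memb y K)
  memb-* (q , false) = memb-starred q
  memb-* (q , true) = trans (sym (not-involutive _)) (cong not (sym (memb-starred q)))

  memb-memberAt : ∀ K′ q → memb (memberAt K′ q) K ≡ Agree K′ K q
  memb-memberAt K′ q with memb (q , false) K′
  ... | true = sym (not-involutive _)
  ... | false = memb-starred q

admissible-from-complement : ∀ {n} (K : SubJ n) → (∀ q → memb (q , true) K ≡ not (memb (q , false) K)) →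
                             AdmissibleNSet K
admissible-from-complement (P , Q) compl = admissible , complement⇒∣P∣+∣Q∣≡n P Q compl
  where
  both : ∀ k → (k , false) ∈J (P , Q) → (k , true) ∈J (P , Q) → ⊥
  both k p q = not-¬ refl (trans (sym (∈J⇒memb (k , true) (P , Q) q))
                 (trans (compl k) (cong not (∈J⇒memb (k , false) (P , Q) p))))
  admissible : Admissible (P , Q)
  admissible (k , false) = both k
  admissible (k , true) q p = both k p q

vec-ext : ∀ {n} {A : Set} {v w : Vec A n} → (∀ k → lookup v k ≡ lookup w k) → v ≡ w
vec-ext {v = v} {w} eq = trans (sym (Vec.tabulate∘lookup v)) (trans (Vec.tabulate-cong eq) (Vec.tabulate∘lookup w))

memb-ext : ∀ {n} {K K′ : SubJ n} → (∀ y → memb y K ≡ memb y K′) → K ≡ K′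
memb-ext eq = cong₂ _,_ (vec-ext (λ q → eq (q , false))) (vec-ext (λ q → eq (q , true)))

InSymDiff : ∀ {n} → J n → SubJ n → SubJ n → Set
InSymDiff y K K′ = (y ∈J K × y ∉J K′) ⊎ (y ∈J K′ × y ∉J K)

memb-not⇒InSymDiff : ∀ {n} (y : J n) K K′ → memb y K′ ≡ not (memb y K) → InSymDiff y K K′
memb-not⇒InSymDiff y K K′ eq with memb y K in e
... | true = inj₁ (memb⇒∈J y K e , λ y∈K′ → not-¬ refl (trans (sym (∈J⇒memb y K′ y∈K′)) eq))
... | false = inj₂ (memb⇒∈J y K′ eq , λ y∈K → not-¬ refl (trans (sym (∈J⇒memb y K y∈K)) e))

memb-≡⇒¬InSymDiff : ∀ {n} (y : J n) K K′ → memb y K ≡ memb y K′ → ¬ InSymDiff y K K′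
memb-≡⇒¬InSymDiff y K K′ eq (inj₁ (y∈K , y∉K′)) = y∉K′ (memb⇒∈J y K′ (trans (sym eq) (∈J⇒memb y K y∈K)))
memb-≡⇒¬InSymDiff y K K′ eq (inj₂ (y∈K′ , y∉K)) = y∉K (memb⇒∈J y K (trans eq (∈J⇒memb y K′ y∈K′)))

module _ {n} {K K′ : SubJ n} (K-adm : AdmissibleNSet K) (K′-adm : AdmissibleNSet K′) where

  memb-signed⇒unsigned : ∀ q b → memb (q , b) K ≡ memb (q , b) K′ → memb (q , false) K ≡ memb (q , false) K′
  memb-signed⇒unsigned q false eq = eq
  memb-signed⇒unsigned q true eq = not-injective (trans (sym (memb-starred K-adm q)) (trans eq (memb-starred K′-adm q)))

  memb-unsigned⇒signed : ∀ q b → memb (q , false) K ≡ memb (q , false) K′ → memb (q , b) K ≡ memb (q , b) K′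
  memb-unsigned⇒signed q false eq = eq
  memb-unsigned⇒signed q true eq = trans (memb-starred K-adm q) (trans (cong not eq) (sym (memb-starred K′-adm q)))

module _ {n} (i : Fin n) where

  transp-on : ∀ y → proj₁ y ≡ i → transp i y ≡ y *
  transp-on (k , b) k≡i with k Fin.≟ i
  ... | yes _ = refl
  ... | no k≢i = ⊥-elim (k≢i k≡i)

  transp-off : ∀ y → proj₁ y ≢ i → transp i y ≡ y
  transp-off (k , b) k≢i with k Fin.≟ i
  ... | yes k≡i = ⊥-elim (k≢i k≡i)
  ... | no _ = refl

  transp-index : ∀ y → proj₁ (transp i y) ≡ proj₁ y
  transp-index (k , b) with k Fin.≟ i
  ... | yes _ = refl
  ... | no _ = refl

  transp-* : ∀ y → transp i (y *) ≡ (transp i y) *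
  transp-* (k , b) with k Fin.≟ i
  ... | yes _ = refl
  ... | no _ = refl

  transp-involutive : ∀ y → transp i (transp i y) ≡ y
  transp-involutive (k , b) with k Fin.≟ i
  ... | yes refl = trans (transp-on (i , not b) refl) (cong (i ,_) (not-involutive b))
  ... | no k≢i = transp-off (k , b) k≢i

  transp-injective : ∀ {y y′} → transp i y ≡ transp i y′ → y ≡ y′
  transp-injective {y} {y′} eq =
    trans (sym (transp-involutive y)) (trans (cong (transp i) eq) (transp-involutive y′))

  memb-transpSet : ∀ K y → memb y (transpSet i K) ≡ memb (transp i y) K
  memb-transpSet K (k , false) = Vec.lookup∘tabulate _ k
  memb-transpSet K (k , true) = Vec.lookup∘tabulate _ k

  ∈J-transpSet⁺ : ∀ K y → transp i y ∈J K → y ∈J transpSet i K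
  ∈J-transpSet⁺ K y σy∈K = memb⇒∈J y _ (trans (memb-transpSet K y) (∈J⇒memb _ K σy∈K))

  ∈J-transpSet⁻ : ∀ K y → y ∈J transpSet i K → transp i y ∈J K
  ∈J-transpSet⁻ K y y∈σK = memb⇒∈J _ K (trans (sym (memb-transpSet K y)) (∈J⇒memb y _ y∈σK))

  transpSet-involutive : ∀ K → transpSet i (transpSet i K) ≡ K
  transpSet-involutive K = memb-ext λ y → begin
    memb y (transpSet i (transpSet i K)) ≡⟨ memb-transpSet (transpSet i K) y ⟩
    memb (transp i y) (transpSet i K)    ≡⟨ memb-transpSet K (transp i y) ⟩
    memb (transp i (transp i y)) K       ≡⟨ cong (λ z → memb z K) (transp-involutive y) ⟩
    memb y K                             ∎
    where open ≡-Reasoning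

  module _ {K : SubJ n} (K-adm : AdmissibleNSet K) where

    memb-transpSet-on : ∀ y → proj₁ y ≡ i → memb y (transpSet i K) ≡ not (memb y K)
    memb-transpSet-on y y≡i =
      trans (memb-transpSet K y) (trans (cong (λ z → memb z K) (transp-on y y≡i)) (memb-* K-adm y))

    memb-transpSet-off : ∀ y → proj₁ y ≢ i → memb y (transpSet i K) ≡ memb y K
    memb-transpSet-off y y≢i = trans (memb-transpSet K y) (cong (λ z → memb z K) (transp-off y y≢i))

    transpSet-admissible : AdmissibleNSet (transpSet i K)
    transpSet-admissible = admissible-from-complement (transpSet i K) λ q → begin
      memb (q , true) (transpSet i K)   ≡⟨ memb-transpSet K (q , true) ⟩
      memb (transp i ((q , false) *)) K ≡⟨ cong (λ z → memb z K) (transp-* (q , false)) ⟩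
      memb (transp i (q , false) *) K   ≡⟨ memb-* K-adm (transp i (q , false)) ⟩
      not (memb (transp i (q , false)) K) ≡⟨ cong not (memb-transpSet K (q , false)) ⟨
      not (memb (q , false) (transpSet i K)) ∎
      where open ≡-Reasoning

    parity-transpSet : parity (starCount (transpSet i K)) ≡ not (parity (starCount K))
    parity-transpSet = xor≡true⇒≡not (trans (parity-hamming (proj₂ K) (proj₂ (transpSet i K)))
      (cong parity (hamming-one (proj₂ K) (proj₂ (transpSet i K)) i
        (λ k k≢i → sym (memb-transpSet-off (k , true) k≢i))
        (λ eq → not-¬ refl (trans eq (memb-transpSet-on (i , true) refl))))))

    symDiff-transpSet : SymDiffIsPair K (transpSet i K) (i , false)
    symDiff-transpSet y with proj₁ y Fin.≟ i
    ... | yes refl = (λ _ → pair-member y) , (λ _ → memb-not⇒InSymDiff y K _ (memb-transpSet-on y refl))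
      where
      pair-member : ∀ (y : J n) → y ≡ (proj₁ y , false) ⊎ y ≡ (proj₁ y , true)
      pair-member (k , false) = inj₁ refl
      pair-member (k , true) = inj₂ refl
    ... | no y≢i = (λ d → ⊥-elim (memb-≡⇒¬InSymDiff y K _ (sym (memb-transpSet-off y y≢i)) d))
                 , (λ { (inj₁ refl) → ⊥-elim (y≢i refl) ; (inj₂ refl) → ⊥-elim (y≢i refl) })

-- Boolean sequences and domination

count : ℕ → (ℕ → Bool) → ℕ
count zero s = 0
count (suc k) s = count k s + 𝟙 (s k)

count-cong : ∀ k {s t} → (∀ j → j < k → s j ≡ t j) → count k s ≡ count k t
count-cong zero eq = refl
count-cong (suc k) eq = cong₂ _+_ (count-cong k (λ j j<k → eq j (ℕ.m<n⇒m<1+n j<k))) (cong 𝟙 (eq k ℕ.≤-refl))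

count-≤ : ∀ k s → count k s ≤ k
count-≤ zero s = z≤n
count-≤ (suc k) s = ℕ.≤-trans (ℕ.+-mono-≤ (count-≤ k s) (𝟙≤1 (s k))) (ℕ.≤-reflexive (ℕ.+-comm k 1))

count-all : ∀ k s → (∀ j → j < k → s j ≡ true) → count k s ≡ k
count-all zero s all = refl
count-all (suc k) s all =
  trans (cong₂ _+_ (count-all k s (λ j j<k → all j (ℕ.m<n⇒m<1+n j<k))) (cong 𝟙 (all k ℕ.≤-refl))) (ℕ.+-comm k 1)

count-false-< : ∀ k s j → j < k → s j ≡ false → count k s < k
count-false-< (suc k) s j j<1+k sj≡false with j ℕ.≟ k
... | yes refl = ℕ.≤-trans (ℕ.≤-reflexive (cong (λ b → suc (count j s + 𝟙 b)) sj≡false))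
                   (ℕ.≤-trans (ℕ.≤-reflexive (cong suc (ℕ.+-identityʳ _))) (s≤s (count-≤ j s)))
... | no j≢k = ℕ.≤-trans
  (ℕ.+-mono-≤ (count-false-< k s j (ℕ.≤∧≢⇒< (ℕ.≤-pred j<1+k) j≢k) sj≡false) (𝟙≤1 (s k)))
  (ℕ.≤-reflexive (ℕ.+-comm k 1))

count-≡⇒all : ∀ k s → count k s ≡ k → ∀ j → j < k → s j ≡ true
count-≡⇒all k s eq j j<k with s j in sj
... | true = refl
... | false = ⊥-elim (ℕ.<-irrefl eq (count-false-< k s j j<k sj))

count-mono : ∀ k {s t} → (∀ j → j < k → 𝟙 (s j) ≤ 𝟙 (t j)) → count k s ≤ count k t
count-mono zero le = z≤n
count-mono (suc k) le = ℕ.+-mono-≤ (count-mono k (λ j j<k → le j (ℕ.m<n⇒m<1+n j<k))) (le k ℕ.≤-refl)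

count-strict : ∀ k {s t} → (∀ j → j < k → 𝟙 (s j) ≤ 𝟙 (t j)) →
               ∀ j → j < k → s j ≡ false → t j ≡ true → count k s < count k t
count-strict (suc k) {s} {t} le j j<1+k sj tj with j ℕ.≟ k
... | yes refl = ℕ.+-mono-≤-< (count-mono j (λ i i<j → le i (ℕ.m<n⇒m<1+n i<j)))
                   (subst₂ (λ a b → 𝟙 a < 𝟙 b) (sym sj) (sym tj) ℕ.≤-refl)
... | no j≢k = ℕ.+-mono-<-≤ (count-strict k (λ i i<k → le i (ℕ.m<n⇒m<1+n i<k)) j
                   (ℕ.≤∧≢⇒< (ℕ.≤-pred j<1+k) j≢k) sj tj) (le k ℕ.≤-refl)

count-update : ∀ k c s t → c < k → (∀ j → j < k → j ≢ c → s j ≡ t j) →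
               count k s + 𝟙 (t c) ≡ count k t + 𝟙 (s c)
count-update (suc k) c s t c<1+k agree with c ℕ.≟ k
... | yes refl = trans (cong (λ m → m + 𝟙 (s c) + 𝟙 (t c))
                         (count-cong c (λ j j<c → agree j (ℕ.m<n⇒m<1+n j<c) (ℕ.<⇒≢ j<c))))
                       (ℕ+.xy∙z≈xz∙y (count c t) _ _)
... | no c≢k = begin
  count k s + 𝟙 (s k) + 𝟙 (t c) ≡⟨ cong (λ b → count k s + 𝟙 b + 𝟙 (t c)) (agree k ℕ.≤-refl (c≢k ∘ sym)) ⟩
  count k s + 𝟙 (t k) + 𝟙 (t c) ≡⟨ ℕ+.xy∙z≈xz∙y (count k s) _ _ ⟩
  count k s + 𝟙 (t c) + 𝟙 (t k) ≡⟨ cong (_+ 𝟙 (t k)) (count-update k c s t (ℕ.≤∧≢⇒< (ℕ.≤-pred c<1+k) c≢k)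
                                      (λ j j<k → agree j (ℕ.m<n⇒m<1+n j<k))) ⟩
  count k t + 𝟙 (s c) + 𝟙 (t k) ≡⟨ ℕ+.xy∙z≈xz∙y (count k t) _ _ ⟩
  count k t + 𝟙 (t k) + 𝟙 (s c) ∎
  where open ≡-Reasoning

least-below : ∀ n (P : ℕ → Set) → (∀ j → Dec (P j)) →
              (∀ j → j < n → ¬ P j) ⊎ ∃ λ k → k < n × P k × (∀ j → j < k → ¬ P j)
least-below zero P P? = inj₁ (λ _ ())
least-below (suc n) P P? with least-below n P P?
... | inj₂ (k , k<n , Pk , below) = inj₂ (k , ℕ.m<n⇒m<1+n k<n , Pk , below)
... | inj₁ none with P? n
...   | yes Pn = inj₂ (n , ℕ.≤-refl , Pn , none)
...   | no ¬Pn = inj₁ none′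
  where
  none′ : ∀ j → j < suc n → ¬ P j
  none′ j j<1+n with j ℕ.≟ n
  ... | yes refl = ¬Pn
  ... | no j≢n = none j (ℕ.≤∧≢⇒< (ℕ.≤-pred j<1+n) j≢n)

_≈[_]_ : (ℕ → Bool) → ℕ → (ℕ → Bool) → Set
s ≈[ n ] t = ∀ j → j < n → s j ≡ t j

FirstDifference : ℕ → (ℕ → Bool) → (ℕ → Bool) → ℕ → Set
FirstDifference n s t k = k < n × s k ≢ t k × s ≈[ k ] t

≈-or-first-difference : ∀ n s t → s ≈[ n ] t ⊎ ∃ (FirstDifference n s t)
≈-or-first-difference n s t with least-below n (λ j → s j ≢ t j) (λ j → ¬? (s j Bool.≟ t j))
... | inj₁ none = inj₁ (λ j j<n → decidable-stable (s j Bool.≟ t j) (none j j<n))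
... | inj₂ (k , k<n , sk≢tk , below) =
  inj₂ (k , k<n , sk≢tk , λ j j<k → decidable-stable (s j Bool.≟ t j) (below j j<k))

_≤lex[_]_ : (ℕ → Bool) → ℕ → (ℕ → Bool) → Set
s ≤lex[ n ] t = ∀ {k} → FirstDifference n s t k → s k ≡ false × t k ≡ true

≤lex-refutes : ∀ n {s t k} → k < n → s ≈[ k ] t → s k ≡ true → t k ≡ false → ¬ (s ≤lex[ n ] t)
≤lex-refutes n k<n agree s-k t-k s≤t =
  false≢true (trans (sym (proj₁ (s≤t (k<n , (λ eq → false≢true (trans (sym t-k) (trans (sym eq) s-k))) , agree)))) s-k)

≤lex-resp-≈ : ∀ n {s s′ t t′} → s ≈[ n ] s′ → t ≈[ n ] t′ → s ≤lex[ n ] t → s′ ≤lex[ n ] t′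
≤lex-resp-≈ n s≈s′ t≈t′ s≤t (k<n , s′k≢t′k , agree) =
  let sk , tk = s≤t (k<n , (λ eq → s′k≢t′k (trans (sym (s≈s′ _ k<n)) (trans eq (t≈t′ _ k<n))))
                      , λ j j<k → trans (s≈s′ j (ℕ.<-trans j<k k<n))
                                    (trans (agree j j<k) (sym (t≈t′ j (ℕ.<-trans j<k k<n)))))
  in trans (sym (s≈s′ _ k<n)) sk , trans (sym (t≈t′ _ k<n)) tk

flipAt : (ℕ → Bool) → ℕ → ℕ → Bool
flipAt s p j = s j xor (j ≡ᵇ p)

flipAt-off : ∀ s {p j} → j ≢ p → flipAt s p j ≡ s j
flipAt-off s {p} {j} j≢p = trans (cong (s j xor_) (≢⇒≡ᵇ j≢p)) (xor-identityʳ (s j))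

flipAt-on : ∀ s p → flipAt s p p ≡ not (s p)
flipAt-on s p = trans (cong (s p xor_) (≡ᵇ-refl p)) (xor-true (s p))

-- s ⊑[ n ] t is what the Gale order of type D_n says about two admissible n-sets read off
-- along an ordering x₁ ≻ ⋯ ≻ xₙ: prefix counts may only grow, except that the incomparability
-- of xₙ and xₙ* forces agreement in the last position once the counts before it agree.
_⊑[_]_ : (ℕ → Bool) → ℕ → (ℕ → Bool) → Set
s ⊑[ n ] t = (∀ k → k < n → count k s ≤ count k t)
           × (∀ k → suc k ≡ n → count k s ≡ count k t → s k ≡ t k)

⊑-refl : ∀ n s → s ⊑[ n ] s
⊑-refl n s = (λ _ _ → ℕ.≤-refl) , (λ _ _ _ → refl)

⊑-trans : ∀ n {s t u} → s ⊑[ n ] t → t ⊑[ n ] u → s ⊑[ n ] u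
⊑-trans n {s} {t} {u} (s≤t , s-last) (t≤u , t-last) = (λ k k<n → ℕ.≤-trans (s≤t k k<n) (t≤u k k<n)) , last
  where
  last : ∀ k → suc k ≡ n → count k s ≡ count k u → s k ≡ u k
  last k 1+k≡n s≡u = trans (s-last k 1+k≡n s≡t) (t-last k 1+k≡n t≡u)
    where
    k<n : k < n
    k<n = subst (k <_) 1+k≡n ℕ.≤-refl
    s≡t : count k s ≡ count k t
    s≡t = ℕ.≤-antisym (s≤t k k<n) (subst (count k t ≤_) (sym s≡u) (t≤u k k<n))
    t≡u : count k t ≡ count k u
    t≡u = ℕ.≤-antisym (t≤u k k<n) (subst (_≤ count k t) s≡u (s≤t k k<n))

⊑⇒count≤ : ∀ n {s t} → s ⊑[ n ] t → ∀ k → k ≤ n → count k s ≤ count k t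
⊑⇒count≤ n s⊑t k k≤n with ℕ.m≤n⇒m<n∨m≡n k≤n
... | inj₁ k<n = proj₁ s⊑t k k<n
... | inj₂ refl = total n s⊑t
  where
  total : ∀ n {s t} → s ⊑[ n ] t → count n s ≤ count n t
  total zero _ = z≤n
  total (suc m) {s} {t} (s≤t , s-last) with ℕ.m≤n⇒m<n∨m≡n (s≤t m ℕ.≤-refl)
  ... | inj₂ eq = ℕ.≤-reflexive (cong₂ _+_ eq (cong 𝟙 (s-last m refl eq)))
  ... | inj₁ lt = ℕ.≤-trans (ℕ.+-monoʳ-≤ (count m s) (𝟙≤1 (s m)))
                    (ℕ.≤-trans (ℕ.≤-reflexive (ℕ.+-comm (count m s) 1)) (ℕ.≤-trans lt (ℕ.m≤m+n (count m t) _)))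

⊑-prefix-true : ∀ n {s t} → s ⊑[ n ] t → ∀ k → k ≤ n →
                (∀ j → j < k → s j ≡ true) → ∀ j → j < k → t j ≡ true
⊑-prefix-true n {s} {t} s⊑t k k≤n s-true = count-≡⇒all k t
  (ℕ.≤-antisym (count-≤ k t) (subst (_≤ count k t) (count-all k s s-true) (⊑⇒count≤ n s⊑t k k≤n)))

⊑⇒≤lex : ∀ n {s t} → s ⊑[ n ] t → s ≤lex[ n ] t
⊑⇒≤lex n {s} {t} s⊑t {k} (k<n , sk≢tk , agree) = 𝟙-≤-≢ (ℕ.+-cancelˡ-≤ (count k s) _ _
  (subst (λ m → count k s + 𝟙 (s k) ≤ m + 𝟙 (t k)) (sym (count-cong k agree)) (⊑⇒count≤ n s⊑t (suc k) k<n)))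
  where
  𝟙-≤-≢ : 𝟙 (s k) ≤ 𝟙 (t k) → s k ≡ false × t k ≡ true
  𝟙-≤-≢ le with s k | t k
  ... | false | true = refl , refl
  ... | true | true = ⊥-elim (sk≢tk refl)
  ... | false | false = ⊥-elim (sk≢tk refl)
  ... | true | false = ⊥-elim (ℕ.1+n≰n le)

weight : ℕ → (ℕ → Bool) → ℕ
weight zero s = 0
weight (suc m) s = weight m s + count m s

weight-mono : ∀ m {s t} → (∀ k → k < m → count k s ≤ count k t) → weight m s ≤ weight m t
weight-mono zero le = z≤n
weight-mono (suc m) le = ℕ.+-mono-≤ (weight-mono m (λ k k<m → le k (ℕ.m<n⇒m<1+n k<m))) (le m ℕ.≤-refl)

weight-strict : ∀ m {s t} → (∀ k → k < m → count k s ≤ count k t) →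
                ∀ k → k < m → count k s < count k t → weight m s < weight m t
weight-strict (suc m) le k k<1+m lt with k ℕ.≟ m
... | yes refl = ℕ.+-mono-≤-< (weight-mono k (λ j j<k → le j (ℕ.m<n⇒m<1+n j<k))) lt
... | no k≢m = ℕ.+-mono-<-≤
  (weight-strict m (λ j j<m → le j (ℕ.m<n⇒m<1+n j<m)) k (ℕ.≤∧≢⇒< (ℕ.≤-pred k<1+m) k≢m) lt)
  (le m ℕ.≤-refl)

⊑-≉⇒weight< : ∀ n {s t} → s ⊑[ n ] t → ¬ s ≈[ n ] t → weight (suc n) s < weight (suc n) t
⊑-≉⇒weight< n {s} {t} s⊑t s≉t with ≈-or-first-difference n s t
... | inj₁ s≈t = ⊥-elim (s≉t s≈t)
... | inj₂ (k , diff@(k<n , _ , agree)) =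
  weight-strict (suc n) (λ j j<1+n → ⊑⇒count≤ n s⊑t j (ℕ.≤-pred j<1+n)) (suc k) (s≤s k<n)
    (subst₂ _<_ (cong₂ _+_ (sym (count-cong k agree)) (cong 𝟙 (sym sk))) (cong (λ b → count k t + 𝟙 b) (sym tk))
      (ℕ.+-monoʳ-< (count k t) (s≤s z≤n)))
  where
  sk : s k ≡ false
  sk = proj₁ (⊑⇒≤lex n s⊑t diff)
  tk : t k ≡ true
  tk = proj₂ (⊑⇒≤lex n s⊑t diff)

_⊑?[_]_ : ∀ s n t → Dec (s ⊑[ n ] t)
s ⊑?[ n ] t = prefix? ×-dec last? n
  where
  prefix? : Dec (∀ k → k < n → count k s ≤ count k t)
  prefix? = map′ (λ h k k<n → h k<n) (λ h {k} k<n → h k k<n) (ℕ.allUpTo? (λ k → count k s ℕ.≤? count k t) n)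
  last? : ∀ n → Dec (∀ k → suc k ≡ n → count k s ≡ count k t → s k ≡ t k)
  last? zero = yes (λ _ ())
  last? (suc m) = map′ (λ h → λ { k refl → h }) (λ h → h m refl) ((count m s ℕ.≟ count m t) →-dec (s m Bool.≟ t m))

count-none : ∀ k s → (∀ j → j < k → s j ≡ false) → count k s ≡ 0
count-none zero s none = refl
count-none (suc k) s none = cong₂ _+_ (count-none k s (λ j j<k → none j (ℕ.m<n⇒m<1+n j<k))) (cong 𝟙 (none k ℕ.≤-refl))

count-true-false : ∀ k m s → m ≤ k → (∀ j → j < m → s j ≡ true) → (∀ j → m ≤ j → j < k → s j ≡ false) →
                   count k s ≡ m
count-true-false k m s m≤k true-below false-above with ℕ.m≤n⇒m<n∨m≡n m≤k
... | inj₂ refl = count-all m s true-below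
count-true-false (suc k) m s _ true-below false-above | inj₁ m<1+k =
  trans (cong₂ _+_ (count-true-false k m s (ℕ.≤-pred m<1+k) true-below
                      (λ j m≤j j<k → false-above j m≤j (ℕ.m<n⇒m<1+n j<k)))
                   (cong 𝟙 (false-above k (ℕ.≤-pred m<1+k) ℕ.≤-refl)))
        (ℕ.+-identityʳ m)

count-false-true : ∀ k m s → m ≤ k → (∀ j → j < m → s j ≡ false) → (∀ j → m ≤ j → j < k → s j ≡ true) →
                   count k s + m ≡ k
count-false-true k m s m≤k false-below true-above with ℕ.m≤n⇒m<n∨m≡n m≤k
... | inj₂ refl = cong (_+ m) (count-none m s false-below)
count-false-true (suc k) m s _ false-below true-above | inj₁ m<1+k = begin
  count k s + 𝟙 (s k) + m ≡⟨ cong (λ b → count k s + 𝟙 b + m) (true-above k (ℕ.≤-pred m<1+k) ℕ.≤-refl) ⟩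
  count k s + 1 + m       ≡⟨ ℕ+.xy∙z≈xz∙y (count k s) 1 m ⟩
  count k s + m + 1       ≡⟨ cong (_+ 1) (count-false-true k m s (ℕ.≤-pred m<1+k) false-below
                               (λ j m≤j j<k → true-above j m≤j (ℕ.m<n⇒m<1+n j<k))) ⟩
  k + 1                   ≡⟨ ℕ.+-comm k 1 ⟩
  suc k                   ∎
  where open ≡-Reasoning

count-one-true : ∀ k c s → c < k → (∀ j → j < k → j ≢ c → s j ≡ false) → s c ≡ true → count k s ≡ 1
count-one-true k c s c<k others sc = trans (sym (ℕ.+-identityʳ _))
  (trans (count-update k c s (λ _ → false) c<k others)
      (cong₂ _+_ (count-none k (λ _ → false) (λ _ _ → refl)) (cong 𝟙 sc)))

count-one-false : ∀ k c s → c < k → (∀ j → j < k → j ≢ c → s j ≡ true) → s c ≡ false → count k s + 1 ≡ k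
count-one-false k c s c<k others sc = trans (count-update k c s (λ _ → true) c<k others)
  (trans (cong₂ _+_ (count-all k (λ _ → true) (λ _ _ → refl)) (cong 𝟙 sc)) (ℕ.+-identityʳ k))

count-two-false : ∀ k c c′ s → c < k → c′ < k → c ≢ c′ → s c ≡ false → s c′ ≡ false → count k s + 2 ≤ k
count-two-false k c c′ s c<k c′<k c≢c′ sc sc′ = subst (_≤ k) (sym (ℕ.+-suc (count k s) 1))
  (subst (λ m → suc m ≤ k) (sym count+1) (count-false-< k t c′ c′<k tc′))
  where
  t : ℕ → Bool
  t i = if does (i ℕ.≟ c) then true else s i
  t-off : ∀ i → i ≢ c → s i ≡ t i
  t-off i i≢c rewrite dec-false (i ℕ.≟ c) i≢c = refl
  tc : t c ≡ true
  tc rewrite dec-true (c ℕ.≟ c) refl = refl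
  tc′ : t c′ ≡ false
  tc′ = trans (sym (t-off c′ (c≢c′ ∘ sym))) sc′
  count+1 : count k s + 1 ≡ count k t
  count+1 = begin
    count k s + 1       ≡⟨ cong (λ b → count k s + 𝟙 b) tc ⟨
    count k s + 𝟙 (t c) ≡⟨ count-update k c s t c<k (λ j _ j≢c → t-off j j≢c) ⟩
    count k t + 𝟙 (s c) ≡⟨ cong (λ b → count k t + 𝟙 b) sc ⟩
    count k t + 0       ≡⟨ ℕ.+-identityʳ _ ⟩
    count k t           ∎
    where open ≡-Reasoning

-- Signatures along a D_n-admissible ordering

injective⇒surjective : ∀ {n} (f : Fin n → Fin n) → Injective _≡_ _≡_ f → ∀ q → ∃ λ p → f p ≡ q
injective⇒surjective {zero} f inj ()
injective⇒surjective {suc m} f inj q with Fin.any? (λ p → f p Fin.≟ q)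
... | yes hit = hit
... | no miss = ⊥-elim (ℕ.1+n≰n (Fin.injective⇒≤ {f = avoid} avoid-injective))
  where
  q≢f : ∀ p → q ≢ f p
  q≢f p eq = miss (p , sym eq)
  avoid : Fin (suc m) → Fin m
  avoid p = punchOut (q≢f p)
  avoid-injective : Injective _≡_ _≡_ avoid
  avoid-injective eq = inj (Fin.punchOut-injective (q≢f _) (q≢f _) eq)

sum-reindex : ∀ {n} (f : Fin n → Fin n) → Injective _≡_ _≡_ f → (h : Fin n → ℕ) → sum (h ∘ f) ≡ sum h
sum-reindex {n} f inj h = sym (sum-permute h π)
  where
  surj : ∀ q → ∃ λ p → f p ≡ q
  surj = injective⇒surjective f inj
  π : Perm.Permutation n n
  π = Perm.permutation f (proj₁ ∘ surj) (proj₂ ∘ surj) (λ p → inj (proj₂ (surj (f p))))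

sum-mono : ∀ {n} {f g : Fin n → ℕ} → (∀ p → f p ≤ g p) → sum f ≤ sum g
sum-mono {zero} le = z≤n
sum-mono {suc n} le = ℕ.+-mono-≤ (le zero) (sum-mono (le ∘ suc))

sum≡count : ∀ n (s : ℕ → Bool) → sum {n} (λ p → 𝟙 (s (toℕ p))) ≡ count n s
sum≡count zero s = refl
sum≡count (suc n) s = trans (sum-init-last {n} (λ p → 𝟙 (s (toℕ p))))
  (cong₂ _+_ (trans (sum-cong-≗ {n} (λ p → cong (𝟙 ∘ s) (Fin.toℕ-inject₁ p))) (sum≡count n s))
             (cong (𝟙 ∘ s) (Fin.toℕ-fromℕ n)))

same-index : ∀ {n} {y y′ : J n} → proj₁ y ≡ proj₁ y′ → y ≡ y′ ⊎ y ≡ y′ *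
same-index {y = k , b} {.k , d} refl with b Bool.≟ d
... | yes refl = inj₁ refl
... | no b≢d = inj₂ (cong (k ,_) (¬-not b≢d))

module Positions {n} (o : DnOrdering n) where

  index : Fin n → Fin n
  index p = proj₁ (x o p)

  index-injective : Injective _≡_ _≡_ index
  index-injective {k} {l} eq = [ x-inj o , ⊥-elim ∘ x-adm o k l ]′ (same-index eq)

  position : Fin n → Fin n
  position q = proj₁ (injective⇒surjective index index-injective q)

  index-position : ∀ q → index (position q) ≡ q
  index-position q = proj₂ (injective⇒surjective index index-injective q)

  position-index : ∀ p → position (index p) ≡ p
  position-index p = index-injective (index-position (index p))

  locate : ∀ y → y ≡ x o (position (proj₁ y)) ⊎ y ≡ x o (position (proj₁ y)) *
  locate y = same-index (sym (index-position (proj₁ y)))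

  signature : SubJ n → ℕ → Bool
  signature K j with j ℕ.<? n
  ... | yes j<n = memb (x o (fromℕ< j<n)) K
  ... | no _ = false

  signature-fromℕ< : ∀ K j (j<n : j < n) → signature K j ≡ memb (x o (fromℕ< j<n)) K
  signature-fromℕ< K j j<n with j ℕ.<? n
  ... | yes j<n′ = cong (λ p → memb (x o p) K)
                     (Fin.toℕ-injective (trans (Fin.toℕ-fromℕ< j<n′) (sym (Fin.toℕ-fromℕ< j<n))))
  ... | no j≮n = ⊥-elim (j≮n j<n)

  signature-toℕ : ∀ K p → signature K (toℕ p) ≡ memb (x o p) K
  signature-toℕ K p = trans (signature-fromℕ< K (toℕ p) (Fin.toℕ<n p))
                            (cong (λ p′ → memb (x o p′) K) (Fin.fromℕ<-toℕ p (Fin.toℕ<n p)))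

  signature-injective : ∀ {K K′} → AdmissibleNSet K → AdmissibleNSet K′ →
                        signature K ≈[ n ] signature K′ → K ≡ K′
  signature-injective {K} {K′} K-adm K′-adm eq = memb-ext λ y → [ at-x y , at-x* y ]′ (locate y)
    where
    agree : ∀ p → memb (x o p) K ≡ memb (x o p) K′
    agree p = trans (sym (signature-toℕ K p)) (trans (eq (toℕ p) (Fin.toℕ<n p)) (signature-toℕ K′ p))
    at-x : ∀ y → y ≡ x o (position (proj₁ y)) → memb y K ≡ memb y K′
    at-x y eq = subst (λ z → memb z K ≡ memb z K′) (sym eq) (agree _)
    at-x* : ∀ y → y ≡ x o (position (proj₁ y)) * → memb y K ≡ memb y K′
    at-x* y eq = subst (λ z → memb z K ≡ memb z K′) (sym eq)
      (trans (memb-* K-adm (x o _)) (trans (cong not (agree _)) (sym (memb-* K′-adm (x o _)))))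

  memberAtPosition : SubJ n → Fin n → J n
  memberAtPosition K p = if memb (x o p) K then x o p else x o p *

  memb-memberAtPosition : ∀ {K} → AdmissibleNSet K → ∀ p → memb (memberAtPosition K p) K ≡ true
  memb-memberAtPosition {K} K-adm p with memb (x o p) K in eq
  ... | true = eq
  ... | false = trans (memb-* K-adm (x o p)) (cong not eq)

  memberAtPosition-injective : ∀ K → Injective _≡_ _≡_ (memberAtPosition K)
  memberAtPosition-injective K {p} {q} eq =
    index-injective (trans (sym (index-memberAtPosition p)) (trans (cong proj₁ eq) (index-memberAtPosition q)))
    where
    index-memberAtPosition : ∀ p → proj₁ (memberAtPosition K p) ≡ index p
    index-memberAtPosition p with memb (x o p) K
    ... | true = refl
    ... | false = refl

  -- The subset { x p | f p true } ∪ { x p * | f p false } of J, as a predicate.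
  threshold : (Fin n → Bool → Bool) → J n → Bool
  threshold f y with locate y
  ... | inj₁ _ = f (position (proj₁ y)) true
  ... | inj₂ _ = f (position (proj₁ y)) false

  threshold-x : ∀ f p → threshold f (x o p) ≡ f p true
  threshold-x f p with locate (x o p)
  ... | inj₁ _ = cong (λ q → f q true) (position-index p)
  ... | inj₂ eq = ⊥-elim (x-adm o p _ eq)

  threshold-x* : ∀ f p → threshold f (x o p *) ≡ f p false
  threshold-x* f p with locate (x o p *)
  ... | inj₁ eq = ⊥-elim (x-adm o _ p (sym eq))
  ... | inj₂ _ = cong (λ q → f q false) (position-index p)

  threshold-memberAtPosition : ∀ f K p → threshold f (memberAtPosition K p) ≡ f p (memb (x o p) K)
  threshold-memberAtPosition f K p with memb (x o p) K
  ... | true = threshold-x f p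
  ... | false = threshold-x* f p

  UpClosed : (J n → Bool) → Set
  UpClosed τ = ∀ {a b} → Above o b a → τ a ≡ true → τ b ≡ true

  gale-threshold : ∀ {A B} → AdmissibleNSet A → AdmissibleNSet B → GaleLeq o A B →
                   ∀ f → UpClosed (threshold f) →
                   sum (λ p → 𝟙 (f p (memb (x o p) A))) ≤ sum (λ p → 𝟙 (f p (memb (x o p) B)))
  gale-threshold {A} {B} A-adm B-adm (a , b , (_ , a-enum) , (_ , b-enum) , a⪯b) f up =
    subst₂ _≤_ (reindex A-adm a a-enum) (reindex B-adm b b-enum) (sum-mono pointwise)
    where
    τ : J n → Bool
    τ = threshold f
    pointwise : ∀ j → 𝟙 (τ (a j)) ≤ 𝟙 (τ (b j))
    pointwise j with a⪯b j | τ (a j) in τa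
    ... | inj₁ eq | _ = ℕ.≤-reflexive (cong 𝟙 (trans (sym τa) (cong τ eq)))
    ... | inj₂ _ | false = z≤n
    ... | inj₂ above | true = ℕ.≤-reflexive (cong 𝟙 (sym (up above τa)))
    reindex : ∀ {K} → AdmissibleNSet K → ∀ c → (∀ y → (y ∈J K → ∃ λ k → c k ≡ y) × _) →
              sum (λ j → 𝟙 (τ (c j))) ≡ sum (λ p → 𝟙 (f p (memb (x o p) K)))
    reindex {K} K-adm c enum = trans (sym (sum-reindex π π-injective (λ j → 𝟙 (τ (c j)))))
      (sum-cong-≗ λ p → cong 𝟙 (trans (cong τ (c-π p)) (threshold-memberAtPosition f K p)))
      where
      hit : ∀ p → ∃ λ j → c j ≡ memberAtPosition K p
      hit p = proj₁ (enum (memberAtPosition K p)) (memb⇒∈J _ K (memb-memberAtPosition K-adm p))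
      π : Fin n → Fin n
      π = proj₁ ∘ hit
      c-π : ∀ p → c (π p) ≡ memberAtPosition K p
      c-π = proj₂ ∘ hit
      π-injective : Injective _≡_ _≡_ π
      π-injective {p} {q} eq = memberAtPosition-injective K (trans (sym (c-π p)) (trans (cong c eq) (c-π q)))

  sum-threshold≡count : ∀ K (h : ℕ → Bool → Bool) →
                        sum (λ p → 𝟙 (h (toℕ p) (memb (x o p) K))) ≡ count n (λ j → h j (signature K j))
  sum-threshold≡count K h = trans (sum-cong-≗ λ p → cong (𝟙 ∘ h (toℕ p)) (sym (signature-toℕ K p)))
                                  (sum≡count n (λ j → h j (signature K j)))

  prefix-up-closed : ∀ k → UpClosed (threshold (λ p u → u ∧ (toℕ p <ᵇ k)))
  prefix-up-closed k (unst-unst {k′} {l′} k′<l′) τl′ = trans (threshold-x _ k′)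
    (<⇒<ᵇ (toℕ k′) k (ℕ.<-trans k′<l′ (<ᵇ⇒< (toℕ l′) k (trans (sym (threshold-x _ l′)) τl′))))
  prefix-up-closed k (unst-star {k′} {l′} _) τl′* with () ← trans (sym (threshold-x* _ l′)) τl′*
  prefix-up-closed k (star-star {k′} {l′} _) τl′* with () ← trans (sym (threshold-x* _ l′)) τl′*

open Positions public

count-prefix : ∀ n k s → k ≤ n → count n (λ j → s j ∧ (j <ᵇ k)) ≡ count k s
count-prefix n k s k≤n with ℕ.m≤n⇒m<n∨m≡n k≤n
... | inj₂ refl = count-cong k (λ j j<k → trans (cong (s j ∧_) (<⇒<ᵇ j k j<k)) (∧-identityʳ (s j)))
count-prefix (suc n) k s _ | inj₁ k<1+n = begin
  count n s<k + 𝟙 (s n ∧ (n <ᵇ k)) ≡⟨ cong (λ b → count n s<k + 𝟙 (s n ∧ b)) (≮⇒<ᵇ n k (ℕ.≤⇒≯ k≤n)) ⟩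
  count n s<k + 𝟙 (s n ∧ false)    ≡⟨ cong (λ b → count n s<k + 𝟙 b) (∧-zeroʳ (s n)) ⟩
  count n s<k + 0                  ≡⟨ ℕ.+-identityʳ _ ⟩
  count n s<k                      ≡⟨ count-prefix n k s k≤n ⟩
  count k s                        ∎
  where
  open ≡-Reasoning
  s<k : ℕ → Bool
  s<k j = s j ∧ (j <ᵇ k)
  k≤n : k ≤ n
  k≤n = ℕ.≤-pred k<1+n

last-up-closed : ∀ {m} (o : DnOrdering (suc m)) →
                 UpClosed o (threshold o (λ p u → if u then toℕ p <ᵇ m else toℕ p ≡ᵇ m))
last-up-closed {m} o (unst-unst {k′} {l′} k′<l′) τl′ = trans (threshold-x o _ k′)
  (<⇒<ᵇ (toℕ k′) m (ℕ.<-trans k′<l′ (<ᵇ⇒< (toℕ l′) _ (trans (sym (threshold-x o _ l′)) τl′))))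
last-up-closed {m} o (unst-star {k′} {l′} not-last) τl′* =
  trans (threshold-x o _ k′) (<⇒<ᵇ (toℕ k′) m (ℕ.≤∧≢⇒< (ℕ.≤-pred (Fin.toℕ<n k′)) k′≢m))
  where
  l′≡m : toℕ l′ ≡ m
  l′≡m = ≡ᵇ⇒≡ (toℕ l′) m (trans (sym (threshold-x* o _ l′)) τl′*)
  k′≢m : toℕ k′ ≢ m
  k′≢m eq = not-last (Fin.toℕ-injective (trans eq (sym l′≡m)) , cong suc eq)
last-up-closed {m} o (star-star {k′} {l′} l′<k′) τl′* =
  ⊥-elim (ℕ.<⇒≱ l′<k′ (subst (toℕ k′ ≤_) (sym l′≡m) (ℕ.≤-pred (Fin.toℕ<n k′))))
  where
  l′≡m : toℕ l′ ≡ m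
  l′≡m = ≡ᵇ⇒≡ (toℕ l′) m (trans (sym (threshold-x* o _ l′)) τl′*)

module _ {n} (o : DnOrdering n) {A B : SubJ n} (A-adm : AdmissibleNSet A) (B-adm : AdmissibleNSet B) (A⪯B : GaleLeq o A B) where

  gale⇒count≤ : ∀ k → k ≤ n → count k (signature o A) ≤ count k (signature o B)
  gale⇒count≤ k k≤n = subst₂ _≤_ (counted A) (counted B)
    (gale-threshold o A-adm B-adm A⪯B (λ p u → u ∧ (toℕ p <ᵇ k)) (prefix-up-closed o k))
    where
    counted : ∀ K → sum (λ p → 𝟙 (memb (x o p) K ∧ (toℕ p <ᵇ k))) ≡ count k (signature o K)
    counted K = trans (sum-threshold≡count o K (λ j u → u ∧ (j <ᵇ k))) (count-prefix n k (signature o K) k≤n)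

gale⇒last≡ : ∀ {n} (o : DnOrdering n) {A B} → AdmissibleNSet A → AdmissibleNSet B → GaleLeq o A B →
             ∀ k → suc k ≡ n → count k (signature o A) ≡ count k (signature o B) →
             signature o A k ≡ signature o B k
gale⇒last≡ o {A} {B} A-adm B-adm A⪯B k refl count≡ = 𝟙-≤-both
  (ℕ.+-cancelˡ-≤ (count k sA) _ _ (subst (λ c → count k sA + 𝟙 (sA k) ≤ c + 𝟙 (sB k)) (sym count≡)
    (gale⇒count≤ o A-adm B-adm A⪯B (suc k) ℕ.≤-refl)))
  (ℕ.+-cancelˡ-≤ (count k sA) _ _ (subst (λ c → count k sA + 𝟙 (not (sA k)) ≤ c + 𝟙 (not (sB k))) (sym count≡)
    (subst₂ _≤_ (counted A) (counted B) (gale-threshold o A-adm B-adm A⪯B _ (last-up-closed o)))))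
  where
  sA sB : ℕ → Bool
  sA = signature o A
  sB = signature o B
  below-last : ∀ b j → j < k → (if b then j <ᵇ k else j ≡ᵇ k) ≡ b
  below-last true j j<k = <⇒<ᵇ j k j<k
  below-last false j j<k = ≢⇒≡ᵇ (ℕ.<⇒≢ j<k)
  at-last : ∀ b → (if b then k <ᵇ k else k ≡ᵇ k) ≡ not b
  at-last true = ≮⇒<ᵇ k k (ℕ.<-irrefl refl)
  at-last false = ≡ᵇ-refl k
  counted : ∀ K → sum (λ p → 𝟙 (if memb (x o p) K then toℕ p <ᵇ k else toℕ p ≡ᵇ k))
                  ≡ count k (signature o K) + 𝟙 (not (signature o K k))
  counted K = trans (sum-threshold≡count o K (λ j u → if u then j <ᵇ k else j ≡ᵇ k))
    (cong₂ _+_ (count-cong k (λ j j<k → below-last (signature o K j) j j<k)) (cong 𝟙 (at-last (signature o K k))))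
  𝟙-≤-both : 𝟙 (sA k) ≤ 𝟙 (sB k) → 𝟙 (not (sA k)) ≤ 𝟙 (not (sB k)) → sA k ≡ sB k
  𝟙-≤-both with sA k | sB k
  ... | true | true = λ _ _ → refl
  ... | false | false = λ _ _ → refl
  ... | true | false = λ ()
  ... | false | true = λ _ ()

gale⇒⊑ : ∀ {n} (o : DnOrdering n) {A B} → AdmissibleNSet A → AdmissibleNSet B → GaleLeq o A B →
         signature o A ⊑[ n ] signature o B
gale⇒⊑ o A-adm B-adm A⪯B =
  (λ k k<n → gale⇒count≤ o A-adm B-adm A⪯B k (ℕ.<⇒≤ k<n)) , gale⇒last≡ o A-adm B-adm A⪯B

module _ {n} (o : DnOrdering n) (𝓑 : SubJ n → Set) (adm : ∀ B → 𝓑 B → AdmissibleNSet B) where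

  private
    W : SubJ n → ℕ
    W C = weight (suc n) (signature o C)

    W-max : ℕ
    W-max = weight (suc n) (λ _ → true)

    W≤W-max : ∀ C → W C ≤ W-max
    W≤W-max C = weight-mono (suc n) λ k _ →
      subst (count k (signature o C) ≤_) (sym (count-all k _ (λ _ _ → refl))) (count-≤ k _)

    _≟SubJ_ : (K K′ : SubJ n) → Dec (K ≡ K′)
    _≟SubJ_ = Product.≡-dec (Vec.≡-dec Bool._≟_) (Vec.≡-dec Bool._≟_)

  -- Classically, climbing the Gale order from C must stop, since every step raises the bounded weight W.
  maximal-above : ∀ fuel C → W-max ∸ W C < fuel → 𝓑 C →
                  ¬ ¬ ∃ λ M → IsGaleMaximal o 𝓑 M × signature o C ⊑[ n ] signature o M
  maximal-above (suc fuel) C bound C∈𝓑 no-max =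
    ¬¬-excluded-middle {A = ∃ λ C′ → 𝓑 C′ × GaleLeq o C C′ × C′ ≢ C} λ where
      (yes (C′ , C′∈𝓑 , C⪯C′ , C′≢C)) →
        let C⊑C′ = gale⇒⊑ o (adm C C∈𝓑) (adm C′ C′∈𝓑) C⪯C′
            W< = ⊑-≉⇒weight< n C⊑C′ λ C≈C′ →
                   C′≢C (sym (signature-injective o (adm C C∈𝓑) (adm C′ C′∈𝓑) C≈C′))
        in maximal-above fuel C′ (ℕ.<-≤-trans (ℕ.∸-monoʳ-< W< (W≤W-max C′)) (ℕ.≤-pred bound)) C′∈𝓑
             λ (M , M-max , C′⊑M) → no-max (M , M-max , ⊑-trans n C⊑C′ C′⊑M)
      (no none) → no-max (C , (C∈𝓑 , λ B B∈𝓑 C⪯B → decidable-stable (B ≟SubJ C) λ B≢C →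
                                       none (B , B∈𝓑 , C⪯B , B≢C))
                          , ⊑-refl n _)

  maximal-dominates : HasUniqueGaleMax o 𝓑 → ∀ M → IsGaleMaximal o 𝓑 M →
                      ∀ B → 𝓑 B → signature o B ⊑[ n ] signature o M
  maximal-dominates (_ , _ , unique) M M-max B B∈𝓑 = decidable-stable (signature o B ⊑?[ n ] signature o M)
    (¬¬-map (λ (M′ , M′-max , B⊑M′) → subst (λ Z → signature o B ⊑[ n ] signature o Z)
                                             (trans (unique M′ M′-max) (sym (unique M M-max))) B⊑M′)
            (maximal-above (suc (W-max ∸ W B)) B ℕ.≤-refl B∈𝓑))

module MaximalBase {n} {𝓑 : SubJ n → Set} (L : LagrangianOrthogonalMatroid n 𝓑) (o : DnOrdering n) where

  M : SubJ n
  M = proj₁ (proj₂ L o)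

  M-max : IsGaleMaximal o 𝓑 M
  M-max = proj₁ (proj₂ (proj₂ L o))

  M∈𝓑 : 𝓑 M
  M∈𝓑 = proj₁ M-max

  M-adm : AdmissibleNSet M
  M-adm = proj₁ L M M∈𝓑

  ⊑M : ∀ K → 𝓑 K → signature o K ⊑[ n ] signature o M
  ⊑M = maximal-dominates o 𝓑 (proj₁ L) (proj₂ L o) M M-max

distance : ∀ {n} → SubJ n → SubJ n → ℕ
distance A B = hamming (proj₂ A) (proj₂ B)

module _ {n} (o : DnOrdering n) where

  distance≡count : ∀ {A B} → AdmissibleNSet A → AdmissibleNSet B →
                   distance A B ≡ count n (λ j → signature o A j xor signature o B j)
  distance≡count {A} {B} A-adm B-adm = begin
    hamming (proj₂ A) (proj₂ B)                       ≡⟨ hamming≡sum (proj₂ A) (proj₂ B) ⟩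
    sum starred-differ                                ≡⟨ sum-reindex (index o) (index-injective o) starred-differ ⟨
    sum (starred-differ ∘ index o)                    ≡⟨ sum-cong-≗ {n} (cong 𝟙 ∘ at-x) ⟩
    sum {n} (λ p → 𝟙 (sA (toℕ p) xor sB (toℕ p)))     ≡⟨ sum≡count n _ ⟩
    count n (λ j → sA j xor sB j)                     ∎
    where
    open ≡-Reasoning
    sA sB : ℕ → Bool
    sA = signature o A
    sB = signature o B
    starred-differ : Fin n → ℕ
    starred-differ q = 𝟙 (memb (q , true) A xor memb (q , true) B)
    at-x : ∀ p → memb (index o p , true) A xor memb (index o p , true) B ≡ sA (toℕ p) xor sB (toℕ p)
    at-x p rewrite signature-toℕ o A p | signature-toℕ o B p with x o p
    ... | q , true = refl
    ... | q , false = trans (cong₂ _xor_ (memb-starred A-adm q) (memb-starred B-adm q))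
                            (xor-annihilates-not (memb (q , false) A) (memb (q , false) B))

  signature-transpSet : ∀ {K} → AdmissibleNSet K → ∀ q j → j < n →
                        signature o (transpSet q K) j ≡ flipAt (signature o K) (toℕ (position o q)) j
  signature-transpSet {K} K-adm q j j<n with index o (fromℕ< j<n) Fin.≟ q
  ... | yes at-q = begin
    signature o (transpSet q K) j        ≡⟨ signature-fromℕ< o _ j j<n ⟩
    memb (x o k) (transpSet q K)         ≡⟨ memb-transpSet-on q K-adm (x o k) at-q ⟩
    not (memb (x o k) K)                 ≡⟨ cong not (signature-fromℕ< o K j j<n) ⟨
    not (signature o K j)                ≡⟨ xor-true (signature o K j) ⟨
    signature o K j xor true             ≡⟨ cong (signature o K j xor_) (≡ᵇ-true j-at-q) ⟨
    flipAt (signature o K) (toℕ (position o q)) j ∎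
    where
    open ≡-Reasoning
    k : Fin n
    k = fromℕ< j<n
    j-at-q : j ≡ toℕ (position o q)
    j-at-q = trans (sym (Fin.toℕ-fromℕ< j<n)) (cong toℕ (trans (sym (position-index o k)) (cong (position o) at-q)))
  ... | no not-at-q = begin
    signature o (transpSet q K) j        ≡⟨ signature-fromℕ< o _ j j<n ⟩
    memb (x o k) (transpSet q K)         ≡⟨ memb-transpSet-off q K-adm (x o k) not-at-q ⟩
    memb (x o k) K                       ≡⟨ signature-fromℕ< o K j j<n ⟨
    signature o K j                      ≡⟨ xor-identityʳ (signature o K j) ⟨
    signature o K j xor false            ≡⟨ cong (signature o K j xor_) (≢⇒≡ᵇ j-not-at-q) ⟨
    flipAt (signature o K) (toℕ (position o q)) j ∎
    where
    open ≡-Reasoning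
    k : Fin n
    k = fromℕ< j<n
    j-not-at-q : j ≢ toℕ (position o q)
    j-not-at-q eq = not-at-q (trans (cong (index o) (Fin.toℕ-injective (trans (Fin.toℕ-fromℕ< j<n) eq))) (index-position o q))

  module _ {K K′ : SubJ n} (K-adm : AdmissibleNSet K) (K′-adm : AdmissibleNSet K′) (q : Fin n) where

    private
      sign : Bool
      sign = proj₂ (x o (position o q))

      at-q : ∀ L → signature o L (toℕ (position o q)) ≡ memb (q , sign) L
      at-q L = trans (signature-toℕ o L (position o q)) (cong (λ i → memb (i , sign) L) (index-position o q))

    signature-position⇒memb : signature o K (toℕ (position o q)) ≡ signature o K′ (toℕ (position o q)) →
                              memb (q , false) K ≡ memb (q , false) K′
    signature-position⇒memb eq = memb-signed⇒unsigned K-adm K′-adm q sign (trans (sym (at-q K)) (trans eq (at-q K′)))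

    memb⇒signature-position : memb (q , false) K ≡ memb (q , false) K′ →
                              signature o K (toℕ (position o q)) ≡ signature o K′ (toℕ (position o q))
    memb⇒signature-position eq = trans (at-q K) (trans (memb-unsigned⇒signed K-adm K′-adm q sign eq) (sym (at-q K′)))

-- Transport along σᵢ

transpOrdering : ∀ {n} → Fin n → DnOrdering n → DnOrdering n
transpOrdering i o = record
  { x = λ k → transp i (x o k)
  ; x-inj = λ eq → x-inj o (transp-injective i eq)
  ; x-adm = λ k l eq → x-adm o k l (transp-injective i (trans eq (sym (transp-* i (x o l)))))
  }

module _ {n} (i : Fin n) (o o′ : DnOrdering n) (x′≡σx : ∀ k → x o′ k ≡ transp i (x o k)) where

  private
    σ : J n → J n
    σ = transp i

    σx* : ∀ k → x o′ k * ≡ σ (x o k *)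
    σx* k = trans (cong _* (x′≡σx k)) (sym (transp-* i (x o k)))

  above-transp : ∀ {a b} → Above o a b → Above o′ (σ a) (σ b)
  above-transp (unst-unst {k} {l} k<l) = subst₂ (Above o′) (x′≡σx k) (x′≡σx l) (unst-unst k<l)
  above-transp (unst-star {k} {l} not-last) = subst₂ (Above o′) (x′≡σx k) (σx* l) (unst-star not-last)
  above-transp (star-star {k} {l} l<k) = subst₂ (Above o′) (σx* k) (σx* l) (star-star l<k)

  enum-transp : ∀ {A a} → IncreasingEnum o A a → IncreasingEnum o′ (transpSet i A) (σ ∘′ a)
  enum-transp {A} {a} (increasing , enumerates) = (λ k l k<l → above-transp (increasing k l k<l)) , λ y →
    (λ y∈σA → let k , ak≡σy = proj₁ (enumerates (σ y)) (∈J-transpSet⁻ i A y y∈σA)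
              in k , trans (cong σ ak≡σy) (transp-involutive i y)) ,
    (λ { (k , refl) → ∈J-transpSet⁺ i A (σ (a k))
           (subst (_∈J A) (sym (transp-involutive i (a k))) (proj₂ (enumerates (a k)) (k , refl))) })

  gale-transp : ∀ {A B} → GaleLeq o A B → GaleLeq o′ (transpSet i A) (transpSet i B)
  gale-transp (a , b , a-enum , b-enum , a⪯b) = σ ∘′ a , σ ∘′ b , enum-transp a-enum , enum-transp b-enum , λ k →
    [ (λ eq → inj₁ (cong σ eq)) , (λ above → inj₂ (above-transp above)) ]′ (a⪯b k)

module _ {n} (i : Fin n) (o : DnOrdering n) where

  gale-transpOrdering : ∀ {A B} → GaleLeq o A B → GaleLeq (transpOrdering i o) (transpSet i A) (transpSet i B)
  gale-transpOrdering = gale-transp i o (transpOrdering i o) (λ _ → refl)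

  gale-transpOrdering⁻ : ∀ {A B} → GaleLeq (transpOrdering i o) A B → GaleLeq o (transpSet i A) (transpSet i B)
  gale-transpOrdering⁻ = gale-transp i (transpOrdering i o) o (λ k → sym (transp-involutive i (x o k)))

module _ {n} (i : Fin n) (𝓑 : SubJ n → Set) where

  private
    σ𝓑 : SubJ n → Set
    σ𝓑 = imageCollection i 𝓑

  transpSet∈image : ∀ {B} → 𝓑 B → σ𝓑 (transpSet i B)
  transpSet∈image {B} B∈𝓑 = B , B∈𝓑 , refl

  image⇒transpSet∈ : ∀ {K} → σ𝓑 K → 𝓑 (transpSet i K)
  image⇒transpSet∈ (B , B∈𝓑 , refl) = subst 𝓑 (sym (transpSet-involutive i B)) B∈𝓑

  module _ (o : DnOrdering n) where

    image-maximal⇒ : ∀ M → IsGaleMaximal o σ𝓑 M → IsGaleMaximal (transpOrdering i o) 𝓑 (transpSet i M)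
    image-maximal⇒ M (M∈σ𝓑 , M-max) = image⇒transpSet∈ M∈σ𝓑 , λ B B∈𝓑 σM⪯B →
      trans (sym (transpSet-involutive i B)) (cong (transpSet i) (M-max (transpSet i B) (transpSet∈image B∈𝓑)
        (subst (λ Z → GaleLeq o Z (transpSet i B)) (transpSet-involutive i M) (gale-transpOrdering⁻ i o σM⪯B))))

    maximal⇒image : ∀ M → IsGaleMaximal (transpOrdering i o) 𝓑 M → IsGaleMaximal o σ𝓑 (transpSet i M)
    maximal⇒image M (M∈𝓑 , M-max) = transpSet∈image M∈𝓑 , λ where
      K (B , B∈𝓑 , refl) σM⪯σB → cong (transpSet i) (M-max B B∈𝓑
        (subst₂ (GaleLeq (transpOrdering i o)) (transpSet-involutive i M) (transpSet-involutive i B)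
          (gale-transpOrdering i o σM⪯σB)))

  image-matroid : LagrangianOrthogonalMatroid n 𝓑 → LagrangianOrthogonalMatroid n σ𝓑
  image-matroid (adm , unique-max) = (λ { K (B , B∈𝓑 , refl) → transpSet-admissible i (adm B B∈𝓑) }) , λ o →
    let M , M-max , M-unique = unique-max (transpOrdering i o)
    in transpSet i M , maximal⇒image o M M-max , λ M′ M′-max →
         trans (sym (transpSet-involutive i M′)) (cong (transpSet i) (M-unique _ (image-maximal⇒ o M′ M′-max)))

module _ {n} (i : Fin n) (o : DnOrdering n) where

  position-transpOrdering : ∀ q → position (transpOrdering i o) q ≡ position o q
  position-transpOrdering q = index-injective o (trans (sym (transp-index i (x o (position (transpOrdering i o) q))))
                                                      (trans (index-position (transpOrdering i o) q) (sym (index-position o q))))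

  signature-transpOrdering : ∀ {K} → AdmissibleNSet K → ∀ j → j < n →
                             signature (transpOrdering i o) K j ≡ flipAt (signature o K) (toℕ (position o i)) j
  signature-transpOrdering {K} K-adm j j<n = begin
    signature (transpOrdering i o) K j ≡⟨ signature-fromℕ< (transpOrdering i o) K j j<n ⟩
    memb (transp i (x o k)) K          ≡⟨ memb-transpSet i K (x o k) ⟨
    memb (x o k) (transpSet i K)       ≡⟨ signature-fromℕ< o (transpSet i K) j j<n ⟨
    signature o (transpSet i K) j      ≡⟨ signature-transpSet o K-adm i j j<n ⟩
    flipAt (signature o K) (toℕ (position o i)) j ∎
    where
    open ≡-Reasoning
    k : Fin n
    k = fromℕ< j<n

-- Orderings in three blocks

lookupOr : ∀ {A : Set} → List A → ℕ → A → A
lookupOr [] j a = a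
lookupOr (b ∷ bs) zero a = b
lookupOr (b ∷ bs) (suc j) a = lookupOr bs j a

lookupOr-++ˡ : ∀ {A : Set} (xs ys : List A) j a → j < length xs → lookupOr (xs ++ ys) j a ≡ lookupOr xs j a
lookupOr-++ˡ (b ∷ xs) ys zero a _ = refl
lookupOr-++ˡ (b ∷ xs) ys (suc j) a (s≤s j<len) = lookupOr-++ˡ xs ys j a j<len

lookupOr-++ʳ : ∀ {A : Set} (xs ys : List A) j a → lookupOr (xs ++ ys) (length xs + j) a ≡ lookupOr ys j a
lookupOr-++ʳ [] ys j a = refl
lookupOr-++ʳ (b ∷ xs) ys j a = lookupOr-++ʳ xs ys j a

lookupOr-tabulate : ∀ {A : Set} n (f : Fin n → A) (q : Fin n) a → lookupOr (List.tabulate f) (toℕ q) a ≡ f q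
lookupOr-tabulate (suc n) f zero a = refl
lookupOr-tabulate (suc n) f (suc q) a = lookupOr-tabulate n (f ∘ suc) q a

lookupOr-filterᵇ : ∀ {A : Set} (b : A → Bool) xs j a → j < length (filterᵇ b xs) →
                   b (lookupOr (filterᵇ b xs) j a) ≡ true
lookupOr-filterᵇ b (y ∷ xs) j a j<len with b y in by
lookupOr-filterᵇ b (y ∷ xs) zero a _ | true = by
lookupOr-filterᵇ b (y ∷ xs) (suc j) a (s≤s j<len) | true = lookupOr-filterᵇ b xs j a j<len
... | false = lookupOr-filterᵇ b xs j a j<len

∈-filterᵇ : ∀ {A : Set} (b : A → Bool) xs (y : A) a →
            (∃ λ j → j < length xs × lookupOr xs j a ≡ y) → b y ≡ true →
            ∃ λ j → j < length (filterᵇ b xs) × lookupOr (filterᵇ b xs) j a ≡ y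
∈-filterᵇ b (y ∷ xs) .y a (zero , _ , refl) by with b y | by
... | true | _ = zero , s≤s z≤n , refl
∈-filterᵇ b (z ∷ xs) y a (suc j , s≤s j<len , eq) by with b z | ∈-filterᵇ b xs y a (j , j<len , eq) by
... | true | (j′ , j′<len , eq′) = suc j′ , s≤s j′<len , eq′
... | false | found = found

length-filterᵇ-tabulate : ∀ {A : Set} n (f : Fin n → A) (b : A → Bool) →
                          length (filterᵇ b (List.tabulate f)) ≡ sum (λ q → 𝟙 (b (f q)))
length-filterᵇ-tabulate zero f b = refl
length-filterᵇ-tabulate (suc n) f b with b (f zero)
... | true = cong suc (length-filterᵇ-tabulate n (f ∘ suc) b)
... | false = length-filterᵇ-tabulate n (f ∘ suc) b

sum-zero : ∀ n → sum {n} (λ _ → 0) ≡ 0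
sum-zero zero = refl
sum-zero (suc n) = sum-zero n

sum-one : ∀ n → sum {n} (λ _ → 1) ≡ n
sum-one zero = refl
sum-one (suc n) = cong suc (sum-one n)

sum-indicator : ∀ {n} (p : Fin n) → sum (λ q → 𝟙 (does (q Fin.≟ p))) ≡ 1
sum-indicator {suc n} zero = cong suc (sum-zero n)
sum-indicator {suc n} (suc p) = sum-indicator p

surjective⇒injective : ∀ {n} (f : Fin n → Fin n) → (∀ q → ∃ λ p → f p ≡ q) → Injective _≡_ _≡_ f
surjective⇒injective {n} f surj {a} {b} fa≡fb = trans (sym (g∘f a)) (trans (cong g fa≡fb) (g∘f b))
  where
  g : Fin n → Fin n
  g = proj₁ ∘ surj
  f∘g : ∀ q → f (g q) ≡ q
  f∘g = proj₂ ∘ surj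
  g∘f : ∀ a → g (f a) ≡ a
  g∘f a with injective⇒surjective g (λ {u} {v} eq → trans (sym (f∘g u)) (trans (cong f eq) (f∘g v))) a
  ... | a′ , refl = cong g (f∘g a′)

module BlockOrder {n} (d : Fin n → Bool) (p : Fin n) (dp : d p ≡ true) where

  private
    _≡ᶠ_ : Fin n → Fin n → Bool
    q ≡ᶠ q′ = does (q Fin.≟ q′)

    late : Fin n → Bool
    late q = d q ∧ not (q ≡ᶠ p)

    indices early lates ℓ : List (Fin n)
    indices = List.tabulate id
    early = filterᵇ (not ∘ d) indices
    lates = filterᵇ late indices
    ℓ = early ++ p ∷ lates

    index-in-indices : ∀ q → ∃ λ j → j < length indices × lookupOr indices j p ≡ q
    index-in-indices q = toℕ q , subst (toℕ q <_) (sym (List.length-tabulate id)) (Fin.toℕ<n q) , lookupOr-tabulate n id q p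

  abstract
    split : ℕ
    split = length early

    length-ℓ : length ℓ ≡ n
    length-ℓ = begin
      length (early ++ p ∷ lates)          ≡⟨ List.length-++ early ⟩
      length early + suc (length lates)   ≡⟨ ℕ.+-suc (length early) _ ⟩
      suc (length early + length lates)
        ≡⟨ cong₂ (λ a b → suc (a + b)) (length-filterᵇ-tabulate n id _) (length-filterᵇ-tabulate n id _) ⟩
      suc (sum 𝟙early + sum 𝟙late)        ≡⟨ cong₂ _+_ (sym (sum-indicator p)) (sym (∑-distrib-+ 𝟙early 𝟙late)) ⟩
      sum 𝟙p + sum (λ q → 𝟙early q + 𝟙late q) ≡⟨ sym (∑-distrib-+ 𝟙p _) ⟩
      sum (λ q → 𝟙p q + (𝟙early q + 𝟙late q)) ≡⟨ sum-cong-≗ {n} one-block ⟩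
      sum {n} (λ _ → 1)                   ≡⟨ sum-one n ⟩
      n                                   ∎
      where
      open ≡-Reasoning
      𝟙p 𝟙early 𝟙late : Fin n → ℕ
      𝟙p q = 𝟙 (q ≡ᶠ p)
      𝟙early q = 𝟙 (not (d q))
      𝟙late q = 𝟙 (late q)
      one-block : ∀ q → 𝟙p q + (𝟙early q + 𝟙late q) ≡ 1
      one-block q with q Fin.≟ p
      ... | yes refl rewrite dp = refl
      ... | no _ with d q
      ...   | true = refl
      ...   | false = refl

    split<n : split < n
    split<n = subst (split <_) length-ℓ (subst (split <_) (sym (List.length-++ early)) (ℕ.m<m+n split (s≤s z≤n)))

    order : Fin n → Fin n
    order k = lookupOr ℓ (toℕ k) p

    order-surjective : ∀ q → ∃ λ k → order k ≡ q
    order-surjective q = let j , j<len , ℓj≡q = in-ℓ q in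
      fromℕ< (subst (j <_) length-ℓ j<len) , trans (cong (λ j′ → lookupOr ℓ j′ p) (Fin.toℕ-fromℕ< _)) ℓj≡q
      where
      in-ℓ : ∀ q → ∃ λ j → j < length ℓ × lookupOr ℓ j p ≡ q
      in-ℓ q with d q in dq
      ... | false = let j , j<len , eq = ∈-filterᵇ (not ∘ d) indices q p (index-in-indices q) (cong not dq) in
        j , subst (j <_) (sym (List.length-++ early)) (ℕ.<-≤-trans j<len (ℕ.m≤m+n _ _)) ,
        trans (lookupOr-++ˡ early _ j p j<len) eq
      ... | true with q Fin.≟ p
      ...   | yes refl = split + 0 , subst (split + 0 <_) (sym (List.length-++ early)) (ℕ.+-monoʳ-< split (s≤s z≤n)) ,
                         lookupOr-++ʳ early (p ∷ lates) 0 p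
      ...   | no q≢p = let j , j<len , eq = ∈-filterᵇ late indices q p (index-in-indices q)
                                             (cong₂ _∧_ dq (cong not (dec-false (q Fin.≟ p) q≢p))) in
        split + suc j , subst (split + suc j <_) (sym (List.length-++ early)) (ℕ.+-monoʳ-< split (s≤s j<len)) ,
        trans (lookupOr-++ʳ early (p ∷ lates) (suc j) p) eq

    order-injective : Injective _≡_ _≡_ order
    order-injective = surjective⇒injective order order-surjective

    order-early : ∀ k → toℕ k < split → d (order k) ≡ false
    order-early k k<split = not-true (trans (cong (not ∘ d) (lookupOr-++ˡ early _ (toℕ k) p k<split))
                                            (lookupOr-filterᵇ (not ∘ d) indices (toℕ k) p k<split))
      where
      not-true : ∀ {b} → not b ≡ true → b ≡ false
      not-true {false} _ = refl

    order-split : ∀ k → toℕ k ≡ split → order k ≡ p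
    order-split k k≡split = trans (cong (λ j → lookupOr ℓ j p) (trans k≡split (sym (ℕ.+-identityʳ split))))
                                  (lookupOr-++ʳ early (p ∷ lates) 0 p)

    order-late : ∀ k → split < toℕ k → d (order k) ≡ true × order k ≢ p
    order-late k split<k with ℕ.m≤n⇒∃[o]m+o≡n split<k
    ... | j , split+1+j≡k = late-parts (trans (cong late order≡) (lookupOr-filterᵇ late indices j p j<len))
      where
      order≡ : order k ≡ lookupOr lates j p
      order≡ = trans (cong (λ j′ → lookupOr ℓ j′ p) (trans (sym split+1+j≡k) (sym (ℕ.+-suc split j))))
                     (lookupOr-++ʳ early (p ∷ lates) (suc j) p)
      j<len : j < length lates
      j<len = ℕ.≤-pred (ℕ.+-cancelˡ-< split (suc j) (suc (length lates))
        (subst (_< split + suc (length lates)) (trans (sym split+1+j≡k) (sym (ℕ.+-suc split j)))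
          (subst (toℕ k <_) (trans (sym length-ℓ) (List.length-++ early)) (Fin.toℕ<n k))))
      late-parts : late (order k) ≡ true → d (order k) ≡ true × order k ≢ p
      late-parts h with d (order k) | order k Fin.≟ p
      ... | true | no ≢p = refl , ≢p
      late-parts () | true | yes _
      late-parts () | false | _

signedOrdering : ∀ {n} (π : Fin n → Fin n) → Injective _≡_ _≡_ π → (Fin n → Bool) → DnOrdering n
signedOrdering π π-injective sign = record
  { x = λ k → (π k , sign (π k))
  ; x-inj = λ eq → π-injective (cong proj₁ eq)
  ; x-adm = λ k l eq → sign-clash k l (π-injective (cong proj₁ eq)) (cong proj₂ eq)
  }
  where
  sign-clash : ∀ k l → k ≡ l → sign (π k) ≢ not (sign (π l))
  sign-clash k .k refl = not-¬ refl

-- The ordering adapted to two admissible n-sets A and B differing over p: first the indices where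
-- they agree, then p signed as in B if μ (as in A otherwise), then the remaining indices signed
-- as in A if μ (as in B otherwise).

module TwoBases {n} {A B : SubJ n} (A-adm : AdmissibleNSet A) (B-adm : AdmissibleNSet B)
                (p : Fin n) (p-differs : memb (p , false) A ≢ memb (p , false) B) (μ : Bool) where

  private
    differ : Fin n → Bool
    differ q = memb (q , false) A xor memb (q , false) B

    open module Blocks = BlockOrder differ p (≢⇒xor≡true p-differs) using (order; order-injective)

    source : Fin n → SubJ n
    source q = if does (q Fin.≟ p) then (if μ then B else A) else (if μ then A else B)

  open Blocks public using (split; split<n)

  abstract
    ordering : DnOrdering n
    ordering = signedOrdering order order-injective (λ q → not (memb (q , false) (source q)))

    index-ordering : ∀ k → index ordering k ≡ order k
    index-ordering k = refl

    signature-source : ∀ K → AdmissibleNSet K → ∀ j (j<n : j < n) →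
                       signature ordering K j ≡ Agree (source (order (fromℕ< j<n))) K (order (fromℕ< j<n))
    signature-source K K-adm j j<n = trans (signature-fromℕ< ordering K j j<n)
      (memb-memberAt K-adm (source (order (fromℕ< j<n))) (order (fromℕ< j<n)))

  private

    Agree-self : ∀ (K : SubJ n) q → Agree K K q ≡ true
    Agree-self K q = cong not (xor-same (memb (q , false) K))

    source-p : source p ≡ (if μ then B else A)
    source-p rewrite dec-true (p Fin.≟ p) refl = refl

    source-≢p : ∀ q → q ≢ p → source q ≡ (if μ then A else B)
    source-≢p q q≢p rewrite dec-false (q Fin.≟ p) q≢p = refl

    at : ∀ j → j < n → Fin n
    at j j<n = order (fromℕ< j<n)

    Agree-source : ∀ b q → Agree (if b then A else B) A q ≡ (b ∨ not (differ q))
                         × Agree (if b then A else B) B q ≡ (not b ∨ not (differ q))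
    Agree-source true q = Agree-self A q , refl
    Agree-source false q = cong not (xor-comm (memb (q , false) B) (memb (q , false) A)) , Agree-self B q

    source-p′ : source p ≡ (if not μ then A else B)
    source-p′ = trans source-p (if-not μ)
      where
      if-not : ∀ b → (if b then B else A) ≡ (if not b then A else B)
      if-not true = refl
      if-not false = refl

    signatures-at : ∀ j (j<n : j < n) → ∀ b → source (at j j<n) ≡ (if b then A else B) →
                    signature ordering A j ≡ (b ∨ not (differ (at j j<n)))
                    × signature ordering B j ≡ (not b ∨ not (differ (at j j<n)))
    signatures-at j j<n b source≡ =
      trans (signature-source A A-adm j j<n) (trans (cong (λ S → Agree S A (at j j<n)) source≡) (proj₁ (Agree-source b _))) ,
      trans (signature-source B B-adm j j<n) (trans (cong (λ S → Agree S B (at j j<n)) source≡) (proj₂ (Agree-source b _)))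

    toℕ-at : ∀ j (j<n : j < n) → toℕ (fromℕ< j<n) ≡ j
    toℕ-at j j<n = Fin.toℕ-fromℕ< j<n

    ∨-not-differ : ∀ b q → differ q ≡ true → (b ∨ not (differ q)) ≡ b
    ∨-not-differ b q dq = trans (cong (λ d → b ∨ not d) dq) (∨-identityʳ b)

    ∨-not-agree : ∀ b q → differ q ≡ false → (b ∨ not (differ q)) ≡ true
    ∨-not-agree b q dq = trans (cong (λ d → b ∨ not d) dq) (∨-zeroʳ b)

  early-signature : ∀ j (j<n : j < n) → j < split → signature ordering A j ≡ true × signature ordering B j ≡ true
  early-signature j j<n j<split =
    let sA , sB = signatures-at j j<n μ (source-≢p (at j j<n) at≢p)
    in trans sA (∨-not-agree μ _ agree) , trans sB (∨-not-agree (not μ) _ agree)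
    where
    agree : differ (at j j<n) ≡ false
    agree = Blocks.order-early (fromℕ< j<n) (subst (_< split) (sym (toℕ-at j j<n)) j<split)
    at≢p : at j j<n ≢ p
    at≢p eq with () ← trans (sym (≢⇒xor≡true p-differs)) (trans (cong differ (sym eq)) agree)

  split-signature : signature ordering A split ≡ not μ × signature ordering B split ≡ μ
  split-signature =
    let sA , sB = signatures-at split split<n (not μ) (trans (cong source at-split) source-p′)
    in trans sA (∨-not-differ (not μ) _ differ-at) ,
       trans sB (trans (∨-not-differ (not (not μ)) _ differ-at) (not-involutive μ))
    where
    at-split : at split split<n ≡ p
    at-split = Blocks.order-split (fromℕ< split<n) (toℕ-at split split<n)
    differ-at : differ (at split split<n) ≡ true
    differ-at = trans (cong differ at-split) (≢⇒xor≡true p-differs)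

  late-signature : ∀ j (j<n : j < n) → split < j → signature ordering A j ≡ μ × signature ordering B j ≡ not μ
  late-signature j j<n split<j =
    let sA , sB = signatures-at j j<n μ (source-≢p (at j j<n) (proj₂ late))
    in trans sA (∨-not-differ μ _ (proj₁ late)) , trans sB (∨-not-differ (not μ) _ (proj₁ late))
    where
    late = Blocks.order-late (fromℕ< j<n) (subst (split <_) (sym (toℕ-at j j<n)) split<j)

  position-p : toℕ (position ordering p) ≡ split
  position-p = trans (cong toℕ (index-injective ordering (trans (index-position ordering p) (sym at-split))))
                     (toℕ-at split split<n)
    where
    at-split : index ordering (fromℕ< split<n) ≡ p
    at-split = trans (index-ordering _) (Blocks.order-split (fromℕ< split<n) (toℕ-at split split<n))

  late-index : ∀ j (j<n : j < n) → split < j →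
               memb (index ordering (fromℕ< j<n) , false) A ≢ memb (index ordering (fromℕ< j<n) , false) B
               × index ordering (fromℕ< j<n) ≢ p
  late-index j j<n split<j rewrite index-ordering (fromℕ< j<n) =
    let differs , ≢p = Blocks.order-late (fromℕ< j<n) (subst (split <_) (sym (toℕ-at j j<n)) split<j)
    in xor≡true⇒≢ differs , ≢p

-- Parity and symmetric exchange

StarParity : ∀ {n} → SubJ n → Bool
StarParity K = parity (starCount K)

parity-distance : ∀ {n} (A B : SubJ n) → StarParity A xor StarParity B ≡ parity (distance A B)
parity-distance A B = parity-hamming (proj₂ A) (proj₂ B)

differing-index : ∀ {n} {A B : SubJ n} → AdmissibleNSet A → AdmissibleNSet B → 0 < distance A B →
                  ∃ λ p → memb (p , false) A ≢ memb (p , false) B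
differing-index {A = A} {B} A-adm B-adm pos =
  let p , differs = hamming-positive (proj₂ A) (proj₂ B) pos
  in p , differs ∘ memb-unsigned⇒signed A-adm B-adm p true

odd≤2⇒1 : ∀ k → k ≤ 2 → parity k ≡ true → k ≡ 1
odd≤2⇒1 1 _ _ = refl
odd≤2⇒1 (suc (suc (suc k))) (s≤s (s≤s ())) _

module _ {n} {𝓑 : SubJ n → Set} (L : LagrangianOrthogonalMatroid n 𝓑) where

  private
    adm : ∀ B → 𝓑 B → AdmissibleNSet B
    adm = proj₁ L

  -- Take the ordering listing the indices where A and B agree, then p (signed as in A), then the
  -- other differences (signed as in B), and let M be the maximal base. Either M improves on A,
  -- and then M is strictly closer to both A and B, or M = A, and B ⊑ A together with the odd
  -- distance forces A and B to differ over p only, where the last-position rule separates them.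
  module ParityStep (A B : SubJ n) (A∈𝓑 : 𝓑 A) (B∈𝓑 : 𝓑 B)
                    (closer : ∀ A′ B′ → 𝓑 A′ → 𝓑 B′ → distance A′ B′ < distance A B →
                              StarParity A′ ≡ StarParity B′)
                    (parities-differ : StarParity A ≢ StarParity B) where

    A-adm : AdmissibleNSet A
    A-adm = adm A A∈𝓑
    B-adm : AdmissibleNSet B
    B-adm = adm B B∈𝓑

    odd : parity (distance A B) ≡ true
    odd = trans (sym (parity-distance A B)) (≢⇒xor≡true parities-differ)

    positive : 0 < distance A B
    positive with distance A B | odd
    ... | suc _ | _ = s≤s z≤n

    p : Fin n
    p = proj₁ (differing-index A-adm B-adm positive)

    open TwoBases A-adm B-adm p (proj₂ (differing-index A-adm B-adm positive)) false

    sA sB : ℕ → Bool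
    sA = signature ordering A
    sB = signature ordering B

    sA-upto-split : ∀ j → j < suc split → sA j ≡ true
    sA-upto-split j j<1+c with ℕ.m≤n⇒m<n∨m≡n (ℕ.≤-pred j<1+c)
    ... | inj₁ j<c = proj₁ (early-signature j (ℕ.<-trans j<c split<n) j<c)
    ... | inj₂ refl = proj₁ split-signature

    sB-off-split : ∀ j → j < n → j ≢ split → sB j ≡ true
    sB-off-split j j<n j≢c with ℕ.<-cmp j split
    ... | tri< j<c _ _ = proj₂ (early-signature j j<n j<c)
    ... | tri≈ _ j≡c _ = ⊥-elim (j≢c j≡c)
    ... | tri> _ _ c<j = proj₂ (late-signature j j<n c<j)

    XAB : ℕ → Bool
    XAB j = sA j xor sB j

    XAB-early : ∀ j → j < split → XAB j ≡ false
    XAB-early j j<c =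
      cong₂ _xor_ (sA-upto-split j (ℕ.m<n⇒m<1+n j<c)) (sB-off-split j (ℕ.<-trans j<c split<n) (ℕ.<⇒≢ j<c))

    XAB-late : ∀ j → split ≤ j → j < n → XAB j ≡ true
    XAB-late j c≤j j<n with ℕ.m≤n⇒m<n∨m≡n c≤j
    ... | inj₂ refl = cong₂ _xor_ (proj₁ split-signature) (proj₂ split-signature)
    ... | inj₁ c<j = cong₂ _xor_ (proj₁ (late-signature j j<n c<j)) (proj₂ (late-signature j j<n c<j))

    distance-AB : distance A B + split ≡ n
    distance-AB = trans (cong (_+ split) (distance≡count ordering A-adm B-adm))
                        (count-false-true n split XAB (ℕ.<⇒≤ split<n) XAB-early XAB-late)

    open MaximalBase L ordering

    sM : ℕ → Bool
    sM = signature ordering M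

    sM-upto-split : ∀ j → j < suc split → sM j ≡ true
    sM-upto-split = ⊑-prefix-true n (⊑M A A∈𝓑) (suc split) split<n sA-upto-split

    M≈A : sM ≈[ n ] sA
    M≈A with ≈-or-first-difference n sM sA
    ... | inj₁ M≈A = M≈A
    ... | inj₂ (j₀ , j₀<n , differs , _) = ⊥-elim (parities-differ (trans (sym (closer M A M∈𝓑 A∈𝓑 closer-MA))
                                                                          (closer M B M∈𝓑 B∈𝓑 closer-MB)))
      where
      c<j₀ : split < j₀
      c<j₀ with ℕ.<-cmp split j₀
      ... | tri< c<j₀ _ _ = c<j₀
      ... | tri≈ _ refl _ = ⊥-elim (differs (trans (sM-upto-split j₀ ℕ.≤-refl) (sym (sA-upto-split j₀ ℕ.≤-refl))))
      ... | tri> _ _ j₀<c = ⊥-elim (differs (trans (sM-upto-split j₀ (ℕ.m<n⇒m<1+n j₀<c))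
                                                    (sym (sA-upto-split j₀ (ℕ.m<n⇒m<1+n j₀<c)))))
      sM-j₀ : sM j₀ ≡ true
      sM-j₀ = trans (¬-not differs) (cong not (proj₁ (late-signature j₀ j₀<n c<j₀)))
      below-XAB : ∀ (s : ℕ → Bool) → (∀ j → j < split → s j ≡ XAB j) →
                  ∀ j → j < n → 𝟙 (s j) ≤ 𝟙 (XAB j)
      below-XAB s agree j j<n with ℕ.<-cmp j split
      ... | tri< j<c _ _ = ℕ.≤-reflexive (cong 𝟙 (agree j j<c))
      ... | tri≈ _ refl _ = subst (λ b → 𝟙 (s j) ≤ 𝟙 b) (sym (XAB-late j ℕ.≤-refl j<n)) (𝟙≤1 (s j))
      ... | tri> _ _ c<j = subst (λ b → 𝟙 (s j) ≤ 𝟙 b) (sym (XAB-late j (ℕ.<⇒≤ c<j) j<n)) (𝟙≤1 (s j))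
      closer-MA : distance M A < distance A B
      closer-MA = subst₂ _<_ (sym (distance≡count ordering M-adm A-adm)) (sym (distance≡count ordering A-adm B-adm))
        (count-strict n (below-XAB _ λ j j<c → trans (cong₂ _xor_ (sM-upto-split j (ℕ.m<n⇒m<1+n j<c))
                                                                   (sA-upto-split j (ℕ.m<n⇒m<1+n j<c))) (sym (XAB-early j j<c)))
          split split<n (cong₂ _xor_ (sM-upto-split split ℕ.≤-refl) (sA-upto-split split ℕ.≤-refl))
          (XAB-late split ℕ.≤-refl split<n))
      closer-MB : distance M B < distance A B
      closer-MB = subst₂ _<_ (sym (distance≡count ordering M-adm B-adm)) (sym (distance≡count ordering A-adm B-adm))
        (count-strict n (below-XAB _ λ j j<c → trans (cong₂ _xor_ (sM-upto-split j (ℕ.m<n⇒m<1+n j<c))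
                                                                   (sB-off-split j (ℕ.<-trans j<c split<n) (ℕ.<⇒≢ j<c)))
                                                      (sym (XAB-early j j<c)))
          j₀ j₀<n (cong₂ _xor_ sM-j₀ (proj₂ (late-signature j₀ j₀<n c<j₀)))
          (XAB-late j₀ (ℕ.<⇒≤ c<j₀) j₀<n))

    impossible : ⊥
    impossible = false≢true (trans (sym (proj₂ split-signature)) (trans last-agrees (proj₁ split-signature)))
      where
      B⊑A : sB ⊑[ n ] sA
      B⊑A = subst (λ Z → sB ⊑[ n ] signature ordering Z) (signature-injective ordering M-adm A-adm M≈A) (⊑M B B∈𝓑)
      count-A : count n sA ≡ suc split
      count-A = count-true-false n (suc split) sA split<n sA-upto-split
                  (λ j c<j j<n → proj₁ (late-signature j j<n c<j))
      count-B : count n sB + 1 ≡ n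
      count-B = count-one-false n split sB split<n sB-off-split (proj₂ split-signature)
      n≤2+split : n ≤ 2 + split
      n≤2+split = subst₂ _≤_ count-B (trans (cong (_+ 1) count-A) (ℕ.+-comm (suc split) 1))
                    (ℕ.+-monoˡ-≤ 1 (⊑⇒count≤ n B⊑A n ℕ.≤-refl))
      distance≡1 : distance A B ≡ 1
      distance≡1 = odd≤2⇒1 (distance A B)
                     (ℕ.+-cancelʳ-≤ split _ _ (subst (_≤ 2 + split) (sym distance-AB) n≤2+split)) odd
      last-agrees : sB split ≡ sA split
      last-agrees = proj₂ B⊑A split (trans (cong (_+ split) (sym distance≡1)) distance-AB)
        (trans (count-all split sB (λ j j<c → sB-off-split j (ℕ.<-trans j<c split<n) (ℕ.<⇒≢ j<c)))
               (sym (count-all split sA (λ j j<c → sA-upto-split j (ℕ.m<n⇒m<1+n j<c)))))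

  same-parity : ∀ A B → 𝓑 A → 𝓑 B → StarParity A ≡ StarParity B
  same-parity A B A∈𝓑 B∈𝓑 = below (suc (distance A B)) A B A∈𝓑 B∈𝓑 ℕ.≤-refl
    where
    below : ∀ m A B → 𝓑 A → 𝓑 B → distance A B < m → StarParity A ≡ StarParity B
    below (suc m) A B A∈𝓑 B∈𝓑 d<1+m = decidable-stable (StarParity A Bool.≟ StarParity B) λ parities-differ →
      ParityStep.impossible A B A∈𝓑 B∈𝓑
        (λ A′ B′ A′∈𝓑 B′∈𝓑 d′<d → below m A′ B′ A′∈𝓑 B′∈𝓑 (ℕ.<-≤-trans d′<d (ℕ.≤-pred d<1+m)))
        parities-differ

  distance-even : ∀ A B → 𝓑 A → 𝓑 B → parity (distance A B) ≡ false
  distance-even A B A∈𝓑 B∈𝓑 = trans (sym (parity-distance A B))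
    (trans (cong (StarParity A xor_) (sym (same-parity A B A∈𝓑 B∈𝓑))) (xor-same (StarParity A)))

module _ {n} {𝓑 : SubJ n → Set} (L : LagrangianOrthogonalMatroid n 𝓑) where

  private
    adm : ∀ B → 𝓑 B → AdmissibleNSet B
    adm = proj₁ L

  -- Take the ordering listing the indices where A and B agree, then x₀ (signed as in B), then the
  -- other differences (signed as in A). The signature of A misses only the position of x₀, and that
  -- of B misses exactly the later ones. The maximal base dominates both, so it misses at most one
  -- position, after that of x₀, and by parity it misses one: it is A with x₀ and y exchanged.
  module Exchange (A B : SubJ n) (A∈𝓑 : 𝓑 A) (B∈𝓑 : 𝓑 B)
                  (x₀ : Fin n) (x₀-differs : memb (x₀ , false) A ≢ memb (x₀ , false) B) where

    A-adm : AdmissibleNSet A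
    A-adm = adm A A∈𝓑
    B-adm : AdmissibleNSet B
    B-adm = adm B B∈𝓑

    open TwoBases A-adm B-adm x₀ x₀-differs true

    sA sB : ℕ → Bool
    sA = signature ordering A
    sB = signature ordering B

    sA-off-split : ∀ j → j < n → j ≢ split → sA j ≡ true
    sA-off-split j j<n j≢c with ℕ.<-cmp j split
    ... | tri< j<c _ _ = proj₁ (early-signature j j<n j<c)
    ... | tri≈ _ j≡c _ = ⊥-elim (j≢c j≡c)
    ... | tri> _ _ c<j = proj₁ (late-signature j j<n c<j)

    sB-upto-split : ∀ j → j < suc split → sB j ≡ true
    sB-upto-split j j<1+c with ℕ.m≤n⇒m<n∨m≡n (ℕ.≤-pred j<1+c)
    ... | inj₁ j<c = proj₂ (early-signature j (ℕ.<-trans j<c split<n) j<c)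
    ... | inj₂ refl = proj₂ split-signature

    open MaximalBase L ordering

    sM : ℕ → Bool
    sM = signature ordering M

    sM-upto-split : ∀ j → j < suc split → sM j ≡ true
    sM-upto-split = ⊑-prefix-true n (⊑M B B∈𝓑) (suc split) split<n sB-upto-split

    n≤count-M+1 : n ≤ count n sM + 1
    n≤count-M+1 = subst (_≤ count n sM + 1) (count-one-false n split sA split<n sA-off-split (proj₁ split-signature))
                    (ℕ.+-monoˡ-≤ 1 (⊑⇒count≤ n (⊑M A A∈𝓑) n ℕ.≤-refl))

    M-misses-one : ∃ λ j₁ → j₁ < n × sM j₁ ≡ false
    M-misses-one with ℕ.anyUpTo? (λ j → sM j Bool.≟ false) n
    ... | yes found = found
    ... | no none = ⊥-elim (false≢true (trans (sym (distance-even L M A M∈𝓑 A∈𝓑)) (cong parity distance≡1)))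
      where
      sM-true : ∀ j → j < n → sM j ≡ true
      sM-true j j<n = ¬-not (λ eq → none (j , j<n , eq))
      distance≡1 : distance M A ≡ 1
      distance≡1 = trans (distance≡count ordering M-adm A-adm)
        (count-one-true n split _ split<n
          (λ j j<n j≢c → cong₂ _xor_ (sM-true j j<n) (sA-off-split j j<n j≢c))
          (cong₂ _xor_ (sM-true split split<n) (proj₁ split-signature)))

    j₁ : ℕ
    j₁ = proj₁ M-misses-one

    j₁<n : j₁ < n
    j₁<n = proj₁ (proj₂ M-misses-one)

    sM-j₁ : sM j₁ ≡ false
    sM-j₁ = proj₂ (proj₂ M-misses-one)

    split<j₁ : split < j₁
    split<j₁ with ℕ.<-cmp split j₁
    ... | tri< c<j₁ _ _ = c<j₁
    ... | tri≈ _ c≡j₁ _ =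
      ⊥-elim (false≢true (trans (sym sM-j₁) (sM-upto-split j₁ (s≤s (ℕ.≤-reflexive (sym c≡j₁))))))
    ... | tri> _ _ j₁<c = ⊥-elim (false≢true (trans (sym sM-j₁) (sM-upto-split j₁ (ℕ.m<n⇒m<1+n j₁<c))))

    sM-off-j₁ : ∀ j → j < n → j ≢ j₁ → sM j ≡ true
    sM-off-j₁ j j<n j≢j₁ = ¬-not λ sM-j → ℕ.<-irrefl refl (ℕ.<-≤-trans (ℕ.+-monoʳ-< (count n sM) (ℕ.n<1+n 1))
      (ℕ.≤-trans (count-two-false n j j₁ sM j<n j₁<n j≢j₁ sM-j sM-j₁) n≤count-M+1))

    y : Fin n
    y = index ordering (fromℕ< j₁<n)

    position-y : toℕ (position ordering y) ≡ j₁
    position-y = trans (cong toℕ (position-index ordering _)) (Fin.toℕ-fromℕ< j₁<n)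

    swapped : SubJ n
    swapped = transpSet x₀ (transpSet y A)

    M≡swapped : M ≡ swapped
    M≡swapped = signature-injective ordering M-adm (transpSet-admissible x₀ (transpSet-admissible y A-adm)) λ j j<n →
      sym (trans (signature-transpSet ordering (transpSet-admissible y A-adm) x₀ j j<n)
        (trans (cong₂ (λ a c → a xor (j ≡ᵇ c)) (signature-transpSet ordering A-adm y j j<n) position-p)
          (trans (cong (λ c → flipAt (flipAt sA c) split j) position-y) (flips j j<n))))
      where
      flips : ∀ j → j < n → flipAt (flipAt sA j₁) split j ≡ sM j
      flips j j<n with j ℕ.≟ split | j ℕ.≟ j₁
      ... | yes refl | _ = begin
        flipAt (flipAt sA j₁) j j ≡⟨ flipAt-on (flipAt sA j₁) j ⟩
        not (flipAt sA j₁ j)      ≡⟨ cong not (flipAt-off sA (ℕ.<⇒≢ split<j₁)) ⟩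
        not (sA j)                ≡⟨ cong not (proj₁ split-signature) ⟩
        true                      ≡⟨ sM-upto-split j ℕ.≤-refl ⟨
        sM j                      ∎
        where open ≡-Reasoning
      ... | no j≢c | yes refl = trans (flipAt-off (flipAt sA j) j≢c)
        (trans (flipAt-on sA j) (trans (cong not (sA-off-split j j<n j≢c)) (sym sM-j₁)))
      ... | no j≢c | no j≢j₁ = trans (flipAt-off (flipAt sA j₁) j≢c)
        (trans (flipAt-off sA j≢j₁) (trans (sA-off-split j j<n j≢c) (sym (sM-off-j₁ j j<n j≢j₁))))

    abstract
      exchange : ∃ λ y → y ≢ x₀ × memb (y , false) A ≢ memb (y , false) B × 𝓑 (transpSet x₀ (transpSet y A))
      exchange = y , proj₂ (late-index j₁ j₁<n split<j₁) , proj₁ (late-index j₁ j₁<n split<j₁) ,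
                 subst 𝓑 M≡swapped M∈𝓑

-- The maximal bases for an ordering and its transport along σᵢ

module MaximalPair {n} {𝓑 : SubJ n → Set} (L : LagrangianOrthogonalMatroid n 𝓑) (i : Fin n)
  (o₁ o₂ : DnOrdering n) (m : ℕ) (position-i : toℕ (position o₁ i) ≡ m)
  (same-position : ∀ q → position o₂ q ≡ position o₁ q)
  (flip-signature : ∀ {K} → AdmissibleNSet K → ∀ j → j < n → signature o₂ K j ≡ flipAt (signature o₁ K) m j)
  (M₁ M₂ : SubJ n) (M₁-max : IsGaleMaximal o₁ 𝓑 M₁) (M₂-max : IsGaleMaximal o₂ 𝓑 M₂) where

  adm : ∀ B → 𝓑 B → AdmissibleNSet B
  adm = proj₁ L

  M₁∈𝓑 : 𝓑 M₁
  M₁∈𝓑 = proj₁ M₁-max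

  M₂∈𝓑 : 𝓑 M₂
  M₂∈𝓑 = proj₁ M₂-max

  M₁-adm : AdmissibleNSet M₁
  M₁-adm = adm M₁ M₁∈𝓑

  M₂-adm : AdmissibleNSet M₂
  M₂-adm = adm M₂ M₂∈𝓑

  α β : ℕ → Bool
  α = signature o₁ M₁
  β = signature o₂ M₂

  ≤lex-α : ∀ K → 𝓑 K → signature o₁ K ≤lex[ n ] α
  ≤lex-α K K∈𝓑 = ⊑⇒≤lex n (maximal-dominates o₁ 𝓑 adm (proj₂ L o₁) M₁ M₁-max K K∈𝓑)

  ≤lex-β : ∀ K → 𝓑 K → signature o₂ K ≤lex[ n ] β
  ≤lex-β K K∈𝓑 = ⊑⇒≤lex n (maximal-dominates o₂ 𝓑 adm (proj₂ L o₂) M₂ M₂-max K K∈𝓑)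

  pos : Fin n → ℕ
  pos q = toℕ (position o₁ q)

  pos<n : ∀ q → pos q < n
  pos<n q = Fin.toℕ<n (position o₁ q)

  pos-injective : ∀ {q q′} → pos q ≡ pos q′ → q ≡ q′
  pos-injective {q} {q′} eq = trans (sym (index-position o₁ q))
    (trans (cong (index o₁) (Fin.toℕ-injective eq)) (index-position o₁ q′))

  signature₁-swap : ∀ {K} → AdmissibleNSet K → ∀ q y j → j < n →
                    signature o₁ (transpSet q (transpSet y K)) j ≡ flipAt (flipAt (signature o₁ K) (pos y)) (pos q) j
  signature₁-swap K-adm q y j j<n
    rewrite signature-transpSet o₁ (transpSet-admissible y K-adm) q j j<n | signature-transpSet o₁ K-adm y j j<n = refl

  signature₂-swap : ∀ {K} → AdmissibleNSet K → ∀ q y j → j < n →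
                    signature o₂ (transpSet q (transpSet y K)) j ≡ flipAt (flipAt (signature o₂ K) (pos y)) (pos q) j
  signature₂-swap K-adm q y j j<n
    rewrite signature-transpSet o₂ (transpSet-admissible y K-adm) q j j<n | signature-transpSet o₂ K-adm y j j<n
          | same-position q | same-position y = refl

  ν : ℕ → Bool
  ν = signature o₁ M₂

  β-off-m : ∀ j → j < n → j ≢ m → β j ≡ ν j
  β-off-m j j<n j≢m = trans (flip-signature M₂-adm j j<n) (flipAt-off ν j≢m)

  m<n : m < n
  m<n = subst (_< n) position-i (pos<n i)

  ν-m : ν m ≡ not (β m)
  ν-m = trans (sym (not-involutive (ν m))) (cong not (trans (sym (flipAt-on ν m)) (sym (flip-signature M₂-adm m m<n))))

  pos-index : ∀ j (j<n : j < n) → pos (index o₁ (fromℕ< j<n)) ≡ j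
  pos-index j j<n = trans (cong toℕ (position-index o₁ (fromℕ< j<n))) (Fin.toℕ-fromℕ< j<n)

  flip-α≤β : ∀ y → 𝓑 (transpSet i (transpSet y M₁)) → flipAt α (pos y) ≤lex[ n ] β
  flip-α≤β y W∈𝓑 = ≤lex-resp-≈ n (λ j j<n → trans (signature₂-swap M₁-adm i y j j<n)
    (trans (cong₂ (λ a b → (a xor (j ≡ᵇ pos y)) xor (j ≡ᵇ b)) (flip-signature M₁-adm j j<n) position-i)
           (xor-xor-cancel (α j) (j ≡ᵇ pos y) (j ≡ᵇ m)))) (λ _ _ → refl) (≤lex-β _ W∈𝓑)

  flip-β≤α : ∀ q y → pos y ≡ m → 𝓑 (transpSet q (transpSet y M₂)) → flipAt β (pos q) ≤lex[ n ] α
  flip-β≤α q y py≡m W∈𝓑 = ≤lex-resp-≈ n (λ j j<n → trans (signature₁-swap M₂-adm q y j j<n)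
    (trans (cong (λ b → (ν j xor (j ≡ᵇ b)) xor (j ≡ᵇ pos q)) py≡m)
           (cong (_xor (j ≡ᵇ pos q)) (sym (flip-signature M₂-adm j j<n))))) (λ _ _ → refl) (≤lex-α _ W∈𝓑)

  flip-flip-β≤β : ∀ q y → 𝓑 (transpSet q (transpSet y M₂)) → flipAt (flipAt β (pos y)) (pos q) ≤lex[ n ] β
  flip-flip-β≤β q y W∈𝓑 = ≤lex-resp-≈ n (signature₂-swap M₂-adm q y) (λ _ _ → refl) (≤lex-β _ W∈𝓑)

  M₁≢M₂-at : ∀ y → memb (y , false) M₁ ≢ memb (y , false) M₂ → α (pos y) ≢ ν (pos y)
  M₁≢M₂-at y differs eq = differs (signature-position⇒memb o₁ M₁-adm M₂-adm y eq)

  -- With α and β both true at m, a second difference beyond a first one at e₁ would let two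
  -- symmetric exchanges produce bases beating M₁ or M₂ lexicographically.
  module TwoDifferences (e₁ e₂ : ℕ) (e₁<e₂ : e₁ < e₂) (e₂<n : e₂ < n)
    (agree : ∀ j → j < e₂ → j ≢ e₁ → α j ≡ β j) (α-e₁ : α e₁ ≡ true) (β-e₁ : β e₁ ≡ false)
    (differ-e₂ : α e₂ ≢ β e₂) (α-m : α m ≡ true) (β-m : β m ≡ true) where

    e₁<n : e₁ < n
    e₁<n = ℕ.<-trans e₁<e₂ e₂<n

    e₂≢e₁ : e₂ ≢ e₁
    e₂≢e₁ = ℕ.>⇒≢ e₁<e₂

    e₁≢m : e₁ ≢ m
    e₁≢m refl = false≢true (trans (sym β-e₁) β-m)

    beyond : ∀ y → pos y ≢ m → pos y ≢ e₁ → α (pos y) ≢ ν (pos y) → e₁ < pos y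
    beyond y py≢m py≢e₁ differs with pos y ℕ.<? e₂
    ... | yes py<e₂ = ⊥-elim (differs (trans (agree (pos y) py<e₂ py≢e₁) (β-off-m (pos y) (pos<n y) py≢m)))
    ... | no py≮e₂ = ℕ.<-≤-trans e₁<e₂ (ℕ.≮⇒≥ py≮e₂)

    flip-below : ∀ s {p} → e₁ < p → ∀ j → j < e₁ → flipAt s p j ≡ s j
    flip-below s e₁<p j j<e₁ = flipAt-off s (ℕ.<⇒≢ (ℕ.<-trans j<e₁ e₁<p))

    α-below : α ≈[ e₁ ] β
    α-below j j<e₁ = agree j (ℕ.<-trans j<e₁ e₁<e₂) (ℕ.<⇒≢ j<e₁)

    flip-α-e₁ : flipAt α e₁ ≈[ e₂ ] β
    flip-α-e₁ j j<e₂ with j ℕ.≟ e₁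
    ... | yes refl = trans (flipAt-on α j) (trans (cong not α-e₁) (sym β-e₁))
    ... | no j≢e₁ = trans (flipAt-off α j≢e₁) (agree j j<e₂ j≢e₁)

    flip-β-e₁ : flipAt β e₁ ≈[ e₂ ] α
    flip-β-e₁ j j<e₂ with j ℕ.≟ e₁
    ... | yes refl = trans (flipAt-on β j) (trans (cong not β-e₁) (sym α-e₁))
    ... | no j≢e₁ = trans (flipAt-off β j≢e₁) (sym (agree j j<e₂ j≢e₁))

    M₁≢M₂-at-i : memb (i , false) M₁ ≢ memb (i , false) M₂
    M₁≢M₂-at-i eq = false≢true (trans (sym (trans ν-m (cong not β-m)))
      (trans (sym (subst (λ j → α j ≡ ν j) position-i (memb⇒signature-position o₁ M₁-adm M₂-adm i eq))) α-m))

    q₁ : Fin n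
    q₁ = index o₁ (fromℕ< e₁<n)

    pos-q₁ : pos q₁ ≡ e₁
    pos-q₁ = pos-index e₁ e₁<n

    M₂≢M₁-at-q₁ : memb (q₁ , false) M₂ ≢ memb (q₁ , false) M₁
    M₂≢M₁-at-q₁ eq = false≢true (trans (sym β-e₁) (trans (β-off-m e₁ e₁<n e₁≢m)
      (trans (subst (λ j → ν j ≡ α j) pos-q₁ (memb⇒signature-position o₁ M₂-adm M₁-adm q₁ eq)) α-e₁)))

    e₂-values : α e₂ ≡ false × β e₂ ≡ true
    e₂-values with Exchange.exchange L M₁ M₂ M₁∈𝓑 M₂∈𝓑 i M₁≢M₂-at-i
    ... | y , y≢i , y-differs , W∈𝓑 with pos y ℕ.≟ e₁
    ...   | yes py≡e₁ =
      let α-e₂ , β-e₂ = subst (λ p → flipAt α p ≤lex[ n ] β) py≡e₁ (flip-α≤β y W∈𝓑)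
                          (e₂<n , (λ eq → differ-e₂ (trans (sym (flipAt-off α e₂≢e₁)) eq)) , flip-α-e₁)
      in trans (sym (flipAt-off α e₂≢e₁)) α-e₂ , β-e₂
    ...   | no py≢e₁ = ⊥-elim (≤lex-refutes n e₁<n
              (λ j j<e₁ → trans (flip-below α e₁<py j j<e₁) (α-below j j<e₁))
              (trans (flipAt-off α (py≢e₁ ∘ sym)) α-e₁) β-e₁ (flip-α≤β y W∈𝓑))
      where
      e₁<py : e₁ < pos y
      e₁<py = beyond y (λ eq → y≢i (pos-injective (trans eq (sym position-i)))) py≢e₁ (M₁≢M₂-at y y-differs)

    impossible : ⊥
    impossible with Exchange.exchange L M₂ M₁ M₂∈𝓑 M₁∈𝓑 q₁ M₂≢M₁-at-q₁
    ... | y , y≢q₁ , y-differs , W∈𝓑 with pos y ℕ.≟ m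
    ...   | yes py≡m = ≤lex-refutes n e₂<n flip-β-e₁
              (trans (flipAt-off β e₂≢e₁) (proj₂ e₂-values)) (proj₁ e₂-values)
              (subst (λ p → flipAt β p ≤lex[ n ] α) pos-q₁ (flip-β≤α q₁ y py≡m W∈𝓑))
    ...   | no py≢m = ≤lex-refutes n e₁<n
              (λ j j<e₁ → trans (flipAt-off (flipAt β (pos y)) (ℕ.<⇒≢ j<e₁)) (flip-below β e₁<py j j<e₁))
              (trans (flipAt-on (flipAt β (pos y)) e₁) (trans (cong not (flipAt-off β (py≢e₁ ∘ sym))) (cong not β-e₁)))
              β-e₁ (subst (λ p → flipAt (flipAt β (pos y)) p ≤lex[ n ] β) pos-q₁ (flip-flip-β≤β q₁ y W∈𝓑))
      where
      py≢e₁ : pos y ≢ e₁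
      py≢e₁ eq = y≢q₁ (pos-injective (trans eq (sym pos-q₁)))
      e₁<py : e₁ < pos y
      e₁<py = beyond y py≢m py≢e₁ (M₁≢M₂-at y (y-differs ∘ sym))

module _ {n} {𝓑 : SubJ n → Set} (L : LagrangianOrthogonalMatroid n 𝓑) (i : Fin n)
  (o₁ o₂ : DnOrdering n) (m : ℕ) (position-i : toℕ (position o₁ i) ≡ m)
  (same-position : ∀ q → position o₂ q ≡ position o₁ q)
  (flip-signature : ∀ {K} → AdmissibleNSet K → ∀ j → j < n → signature o₂ K j ≡ flipAt (signature o₁ K) m j)
  (M₁ M₂ : SubJ n) (M₁-max : IsGaleMaximal o₁ 𝓑 M₁) (M₂-max : IsGaleMaximal o₂ 𝓑 M₂) where

  open MaximalPair L i o₁ o₂ m position-i same-position flip-signature M₁ M₂ M₁-max M₂-max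

  private
    module Swapped = MaximalPair L i o₂ o₁ m (trans (cong toℕ (same-position i)) position-i) (sym ∘ same-position)
      (λ K-adm j j<n → sym (trans (cong (_xor (j ≡ᵇ m)) (flip-signature K-adm j j<n)) (xor-cancelʳ _ _)))
      M₂ M₁ M₂-max M₁-max

  -- The first difference of α and ν can only be where the two orderings disagree, at m.
  equal-or-true-at-m : M₁ ≡ M₂ ⊎ (α m ≡ true × β m ≡ true)
  equal-or-true-at-m with ≈-or-first-difference n α ν
  ... | inj₁ α≈ν = inj₁ (signature-injective o₁ M₁-adm M₂-adm α≈ν)
  ... | inj₂ (f , f<n , α≢ν , below) =
    inj₂ (subst (λ j → α j ≡ true) f≡m α-f , subst (λ j → β j ≡ true) f≡m β-f)
    where
    ν-f,α-f : ν f ≡ false × α f ≡ true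
    ν-f,α-f = ≤lex-α M₂ M₂∈𝓑 (f<n , α≢ν ∘ sym , λ j j<f → sym (below j j<f))
    α-f : α f ≡ true
    α-f = proj₂ ν-f,α-f
    ν-f : ν f ≡ false
    ν-f = proj₁ ν-f,α-f
    β-f : β f ≡ true
    β-f = proj₂ (≤lex-β M₁ M₁∈𝓑 (f<n , differ₂ , agree₂))
      where
      agree₂ : ∀ j → j < f → signature o₂ M₁ j ≡ β j
      agree₂ j j<f = trans (flip-signature M₁-adm j (ℕ.<-trans j<f f<n))
        (trans (cong (_xor (j ≡ᵇ m)) (below j j<f)) (sym (flip-signature M₂-adm j (ℕ.<-trans j<f f<n))))
      differ₂ : signature o₂ M₁ f ≢ β f
      differ₂ eq = α≢ν (trans (sym (xor-cancelʳ (α f) (f ≡ᵇ m))) (trans (cong (_xor (f ≡ᵇ m))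
        (trans (sym (flip-signature M₁-adm f f<n)) (trans eq (flip-signature M₂-adm f f<n)))) (xor-cancelʳ (ν f) (f ≡ᵇ m))))
    f≡m : f ≡ m
    f≡m = ≡ᵇ⇒≡ f m (trans (cong (_xor (f ≡ᵇ m)) (sym ν-f)) (trans (sym (flip-signature M₂-adm f f<n)) β-f))

  module _ (α-m : α m ≡ true) (β-m : β m ≡ true) where

    first-difference : ∃ λ e₁ → e₁ < n × α e₁ ≢ β e₁ × (∀ j → j < e₁ → α j ≡ β j)
    first-difference with ≈-or-first-difference n α β
    ... | inj₂ (e₁ , e₁<n , differs , below) = e₁ , e₁<n , differs , below
    ... | inj₁ α≈β =
      ⊥-elim (false≢true (trans (sym (distance-even L M₁ M₂ M₁∈𝓑 M₂∈𝓑)) (cong parity distance≡1)))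
      where
      distance≡1 : distance M₁ M₂ ≡ 1
      distance≡1 = trans (distance≡count o₁ M₁-adm M₂-adm) (count-one-true n m _ m<n
        (λ j j<n j≢m → trans (cong₂ _xor_ (α≈β j j<n) (sym (β-off-m j j<n j≢m))) (xor-same (β j)))
        (cong₂ _xor_ α-m (trans ν-m (cong not β-m))))

    second-difference : ∀ e₁ → (∀ j → j < n → j ≢ e₁ → α j ≡ β j)
                      ⊎ ∃ λ e₂ → e₂ < n × e₂ ≢ e₁ × α e₂ ≢ β e₂ × (∀ j → j < e₂ → j ≢ e₁ → α j ≡ β j)
    second-difference e₁
      with least-below n (λ j → j ≢ e₁ × α j ≢ β j) (λ j → ¬? (j ℕ.≟ e₁) ×-dec ¬? (α j Bool.≟ β j))
    ... | inj₁ none = inj₁ λ j j<n j≢e₁ →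
      decidable-stable (α j Bool.≟ β j) (λ differs → none j j<n (j≢e₁ , differs))
    ... | inj₂ (e₂ , e₂<n , (e₂≢e₁ , differs) , below) = inj₂ (e₂ , e₂<n , e₂≢e₁ , differs , λ j j<e₂ j≢e₁ →
      decidable-stable (α j Bool.≟ β j) (λ differs → below j j<e₂ (j≢e₁ , differs)))

    one-difference : ∀ e₁ (e₁<n : e₁ < n) → α e₁ ≢ β e₁ → (∀ j → j < n → j ≢ e₁ → α j ≡ β j) →
                     M₂ ≡ transpSet i (transpSet (index o₁ (fromℕ< e₁<n)) M₁)
    one-difference e₁ e₁<n differs others =
      signature-injective o₁ M₂-adm (transpSet-admissible i (transpSet-admissible _ M₁-adm)) λ j j<n → sym (begin
        signature o₁ (transpSet i (transpSet q₁ M₁)) j ≡⟨ signature₁-swap M₁-adm i q₁ j j<n ⟩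
        (α j xor (j ≡ᵇ pos q₁)) xor (j ≡ᵇ pos i)
          ≡⟨ cong₂ (λ a b → (α j xor (j ≡ᵇ a)) xor (j ≡ᵇ b)) (pos-index e₁ e₁<n) position-i ⟩
        flipAt α e₁ j xor (j ≡ᵇ m)                     ≡⟨ cong (_xor (j ≡ᵇ m)) (flipped j j<n) ⟩
        β j xor (j ≡ᵇ m)                               ≡⟨ cong (_xor (j ≡ᵇ m)) (flip-signature M₂-adm j j<n) ⟩
        (ν j xor (j ≡ᵇ m)) xor (j ≡ᵇ m)                ≡⟨ xor-cancelʳ (ν j) (j ≡ᵇ m) ⟩
        ν j                                            ∎)
      where
      open ≡-Reasoning
      q₁ : Fin n
      q₁ = index o₁ (fromℕ< e₁<n)
      flipped : ∀ j → j < n → flipAt α e₁ j ≡ β j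
      flipped j j<n with j ℕ.≟ e₁
      ... | yes refl = trans (flipAt-on α j) (sym (¬-not (differs ∘ sym)))
      ... | no j≢e₁ = trans (flipAt-off α j≢e₁) (others j j<n j≢e₁)

  maximal-pair : ∃ λ q → transpSet i M₂ ≡ transpSet q M₁
  maximal-pair with equal-or-true-at-m
  ... | inj₁ M₁≡M₂ = i , cong (transpSet i) (sym M₁≡M₂)
  ... | inj₂ (α-m , β-m) with first-difference α-m β-m
  ...   | e₁ , e₁<n , e₁-differs , below-e₁ with second-difference α-m β-m e₁
  ...     | inj₁ others = index o₁ (fromℕ< e₁<n) ,
    trans (cong (transpSet i) (one-difference α-m β-m e₁ e₁<n e₁-differs others)) (transpSet-involutive i _)
  ...     | inj₂ (e₂ , e₂<n , e₂≢e₁ , e₂-differs , below-e₂) = ⊥-elim (two-differences (α e₁) refl)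
    where
    e₁<e₂ : e₁ < e₂
    e₁<e₂ = ℕ.≤∧≢⇒< (ℕ.≮⇒≥ (λ e₂<e₁ → e₂-differs (below-e₁ e₂ e₂<e₁))) (e₂≢e₁ ∘ sym)
    β-e₁ : β e₁ ≡ not (α e₁)
    β-e₁ = ¬-not (e₁-differs ∘ sym)
    -- By the symmetry between (o₁ , M₁) and (o₂ , M₂) we may take α e₁ ≡ true.
    two-differences : ∀ b → α e₁ ≡ b → ⊥
    two-differences true α-e₁ = TwoDifferences.impossible e₁ e₂ e₁<e₂ e₂<n below-e₂ α-e₁
      (trans β-e₁ (cong not α-e₁)) e₂-differs α-m β-m
    two-differences false α-e₁ = Swapped.TwoDifferences.impossible e₁ e₂ e₁<e₂ e₂<n
      (λ j j<e₂ j≢e₁ → sym (below-e₂ j j<e₂ j≢e₁)) (trans β-e₁ (cong not α-e₁)) α-e₁ (e₂-differs ∘ sym)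
      β-m α-m

mainTheorem6 : (n : ℕ) (𝓑₁ : SubJ n → Set) (i : Fin n) →
    LagrangianOrthogonalMatroid n 𝓑₁ →
    LagrangianPair n 𝓑₁ (imageCollection i 𝓑₁)
mainTheorem6 n 𝓑₁ i L = L , image-matroid i 𝓑₁ L , opposite-parity , symmetric-difference
  where
  adm : ∀ B → 𝓑₁ B → AdmissibleNSet B
  adm = proj₁ L

  opposite-parity : OppositeParity 𝓑₁ (imageCollection i 𝓑₁)
  opposite-parity B₁ _ B₁∈𝓑 (B , B∈𝓑 , refl) same =
    not-¬ (same-parity L B₁ B B₁∈𝓑 B∈𝓑) (trans same (parity-transpSet i (adm B B∈𝓑)))

  symmetric-difference : ∀ o M₁ M₂ → IsGaleMaximal o 𝓑₁ M₁ → IsGaleMaximal o (imageCollection i 𝓑₁) M₂ →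
                         ∃ λ j → SymDiffIsPair M₁ M₂ j
  symmetric-difference o M₁ M₂ M₁-max M₂-max =
    let q , σM₂≡ = maximal-pair L i o (transpOrdering i o) (toℕ (position o i)) refl
                     (position-transpOrdering i o) (signature-transpOrdering i o)
                     M₁ (transpSet i M₂) M₁-max (image-maximal⇒ i 𝓑₁ o M₂ M₂-max)
    in (q , false) , subst (λ Z → SymDiffIsPair M₁ Z (q , false)) (trans (sym σM₂≡) (transpSet-involutive i M₂))
                   (symDiff-transpSet q (adm M₁ (proj₁ M₁-max)))
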